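{- Let $k\ge 2$ and $n\ge 1$, and let $t$ be a traversal string of length $n$. A chip $c\in\{1,\dots,k^n\}$ can land at the vertex $v_t$ on layer $n+1$ if and only if $a(t,1)\le c\le b(t,1)$.
   Context: The infinite rooted directed $k$-ary tree: every vertex has $k$ children ordered from leftmost (1st) to rightmost ($k$th); the root is on layer 1. A traversal string $t=t_1\cdots t_i$ with $t_\ell\in\{1,\dots,k\}$ determines the vertex $v_t$ (on layer $i+1$) reached from the root by moving at step $\ell$ to the $t_\ell$-th leftmost child. Labeled chip-firing: initially chips labeled $1,\dots,k^n$ are on the root; a vertex holding at least $k$ chips may fire by choosing any $k$ of its chips and sending the chip with the $r$-th smallest label to its $r$-th leftmost child ($r=1,\dots,k$); the game ends when no vertex can fire (stable configuration), in which each vertex of layer $n+1$ holds exactly one chip. A chip can land at $v_t$ (for $t$ of length $n$) if some firing strategy yields a stable configuration with that chip on $v_t$. $a(t,1)$ and $b(t,1)$ denote the smallest and the largest labels of chips that can land at $v_t$. -}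

module Defs where

open import Data.Nat using (ℕ; zero; suc; _≤_; _<_; _^_)
open import Data.Fin as Fin using (Fin; toℕ)
open import Data.List using (List; []; _∷ʳ_; length; filter; allFin)
open import Data.List.Properties using (≡-dec)
open import Data.Vec using (Vec; toList)
open import Data.Product using (Σ; ∃; _×_; _,_)
open import Relation.Binary.PropositionalEquality using (_≡_; _≢_)
open import Relation.Binary.Construct.Closure.ReflexiveTransitive using (Star)
open import Relation.Nullary using (yes; no)
open import Data.Fin.Properties using (any?)

-- A vertex of the infinite k-ary tree is given by its traversal string
-- from the root (the root is the empty string). Child r : Fin k of v is
-- v ∷ʳ r, where Fin.zero is the leftmost (1st) child.
Vertex : ℕ → Set
Vertex k = List (Fin k)

-- There are N chips; the chip with index i : Fin N carries label suc (toℕ i).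
-- A configuration records the vertex on which each chip lies.
Config : ℕ → ℕ → Set
Config k N = Fin N → Vertex k

initial : ∀ {k N} → Config k N
initial _ = []

chipsAt : ∀ {k N} → Config k N → Vertex k → ℕ
chipsAt {k} {N} C v = length (filter (λ i → ≡-dec Fin._≟_ (C i) v) (allFin N))

StrictlyIncreasing : ∀ {k N} → (Fin k → Fin N) → Set
StrictlyIncreasing f = ∀ r s → r Fin.< s → f r Fin.< f s

fireAt : ∀ {k N} → Config k N → Vertex k → (Fin k → Fin N) → Config k N
fireAt {k} C v f i with any? (λ r → f r Fin.≟ i)
... | yes (r , _) = v ∷ʳ r
... | no _ = C i

-- one firing move: at a vertex v, choose k chips on v (listed in increasing
-- label order) and send the r-th smallest to the r-th leftmost child
data Step {k N : ℕ} (C : Config k N) : Config k N → Set where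
  fire : (v : Vertex k) (f : Fin k → Fin N) → StrictlyIncreasing f →
         (∀ r → C (f r) ≡ v) → Step C (fireAt C v f)

Stable : ∀ {k N} → Config k N → Set
Stable {k} C = ∀ v → chipsAt C v < k

CanLand : (k n : ℕ) → Vec (Fin k) n → ℕ → Set
CanLand k n t c =
  Σ (Config k (k ^ n)) λ C →
    Star Step initial C × Stable C ×
    Σ (Fin (k ^ n)) (λ i → suc (toℕ i) ≡ c × C i ≡ toList t)

IsA : (k n : ℕ) → Vec (Fin k) n → ℕ → Set
IsA k n t a = CanLand k n t a × (∀ c → CanLand k n t c → a ≤ c)

IsB : (k n : ℕ) → Vec (Fin k) n → ℕ → Set
IsB k n t b = CanLand k n t b × (∀ c → CanLand k n t c → c ≤ b)

-- Chips are followed through their ranks rather than their labels. A firing sends one chip to each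
-- child, in increasing label order, so in every reachable configuration sibling subtrees have received
-- equally many chips and, for any chip, the number of smaller chips in a subtree decreases from left to
-- right. In a stable configuration this bounds, for a chip of rank ρ among the M k chips reaching a
-- vertex, its rank y among the M chips reaching the child r it passes to (the relation Descends).
-- Conversely every chain of ranks allowed by Descends is realised: while the chosen chip stays at the
-- vertex, fire the j smallest and the k - j largest chips there, until it can move down with the right
-- rank; then treat the children recursively. Finally, for fixed r the ranks ρ admitting some y form an
-- interval, so the labels that can land at v_t form an interval.
module Submission where

open import Data.Empty using (⊥; ⊥-elim)
open import Data.Fin as Fin using (Fin; zero; suc; toℕ; fromℕ<)
open import Data.Fin.Properties as Finₚ using (any?; toℕ<n; toℕ-fromℕ<; toℕ-injective)
open import Data.List using (List; []; _∷_; _∷ʳ_; _++_; length; filter; tabulate; replicate)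
open import Data.List.Properties
  using (≡-dec; ∷ʳ-injective; ∷ʳ-++; length-++; length-++-≤ˡ; ++-identityʳ; ++-assoc; ++-conicalˡ; ∷-injectiveˡ; ∷-injectiveʳ; ++-cancelˡ)
open import Data.Nat
open import Data.Nat.DivMod using (_%_; [m+kn]%n≡m%n; m*n%n≡0; m<n⇒m%n≡m)
open import Data.Nat.Properties
open import Data.Nat.Tactic.RingSolver using (solve-∀)
open import Algebra.Properties.Semiring.Sum +-*-semiring using (sum; sum-cong-≗; ∑-distrib-+; ∑-comm; *-distribˡ-sum)
open import Data.Product using (∃; _×_; _,_; proj₁; proj₂)
open import Data.Sum using (_⊎_; inj₁; inj₂; [_,_]′)
open import Data.Vec using (Vec; toList)
open import Data.Vec.Properties using (length-toList)
open import Function using (_∘_; id)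
open import Function.Bundles using (_⇔_; mk⇔)
open import Function.Definitions using (Injective)
open import Relation.Binary.Construct.Closure.ReflexiveTransitive using (Star; ε; _◅_; _◅◅_)
open import Relation.Binary.Definitions using (DecidableEquality; tri<; tri≈; tri>)
open import Relation.Binary.PropositionalEquality
open import Relation.Nullary using (Dec; yes; no; ¬_)
open import Relation.Unary using (Pred; Decidable)
open import Defs

𝟙 : ∀ {p} {P : Set p} → Dec P → ℕ
𝟙 (yes _) = 1
𝟙 (no _) = 0

𝟙-yes : ∀ {p} {P : Set p} → P → (d : Dec P) → 𝟙 d ≡ 1
𝟙-yes _ (yes _) = refl
𝟙-yes x (no ¬x) = ⊥-elim (¬x x)

𝟙-no : ∀ {p} {P : Set p} → ¬ P → (d : Dec P) → 𝟙 d ≡ 0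
𝟙-no ¬x (yes x) = ⊥-elim (¬x x)
𝟙-no _ (no _) = refl

𝟙≤1 : ∀ {p} {P : Set p} (d : Dec P) → 𝟙 d ≤ 1
𝟙≤1 (yes _) = ≤-refl
𝟙≤1 (no _) = z≤n

𝟙-mono : ∀ {p q} {P : Set p} {Q : Set q} → (P → Q) → (d : Dec P) (e : Dec Q) → 𝟙 d ≤ 𝟙 e
𝟙-mono P⇒Q (yes x) e = ≤-reflexive (sym (𝟙-yes (P⇒Q x) e))
𝟙-mono P⇒Q (no _) e = z≤n

𝟙-cong : ∀ {p q} {P : Set p} {Q : Set q} → (P → Q) → (Q → P) → (d : Dec P) (e : Dec Q) → 𝟙 d ≡ 𝟙 e
𝟙-cong P⇒Q Q⇒P d e = ≤-antisym (𝟙-mono P⇒Q d e) (𝟙-mono Q⇒P e d)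

sum-mono-≤ : ∀ {n} {g h : Fin n → ℕ} → (∀ x → g x ≤ h x) → sum g ≤ sum h
sum-mono-≤ {zero} g≤h = z≤n
sum-mono-≤ {suc n} g≤h = +-mono-≤ (g≤h zero) (sum-mono-≤ (g≤h ∘ suc))

sum-mono-< : ∀ {n} {g h : Fin n → ℕ} → (∀ x → g x ≤ h x) → ∀ x → g x < h x → sum g < sum h
sum-mono-< {suc n} g≤h zero g<h = +-mono-<-≤ g<h (sum-mono-≤ (g≤h ∘ suc))
sum-mono-< {suc n} g≤h (suc x) g<h = +-mono-≤-< (g≤h zero) (sum-mono-< (g≤h ∘ suc) x g<h)

sum-zero : ∀ {n} {g : Fin n → ℕ} → (∀ x → g x ≡ 0) → sum g ≡ 0
sum-zero {zero} g≡0 = refl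
sum-zero {suc n} g≡0 = cong₂ _+_ (g≡0 zero) (sum-zero (g≡0 ∘ suc))

sum-const : ∀ n a → sum {n} (λ _ → a) ≡ n * a
sum-const zero a = refl
sum-const (suc n) a = cong (a +_) (sum-const n a)

sum-delta : ∀ {n} {g : Fin n → ℕ} x₀ → (∀ x → x ≢ x₀ → g x ≡ 0) → sum g ≡ g x₀
sum-delta {suc n} {g} zero g≡0 =
  trans (cong (g zero +_) (sum-zero (λ x → g≡0 (suc x) λ ()))) (+-identityʳ _)
sum-delta {suc n} {g} (suc x₀) g≡0 =
  trans (cong (_+ sum (g ∘ suc)) (g≡0 zero λ ())) (sum-delta x₀ (λ x x≢x₀ → g≡0 (suc x) (x≢x₀ ∘ Finₚ.suc-injective)))

term≤sum : ∀ {n} (g : Fin n → ℕ) x → g x ≤ sum g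
term≤sum g zero = m≤m+n _ _
term≤sum g (suc x) = ≤-trans (term≤sum (g ∘ suc) x) (m≤n+m _ _)

two-terms≤sum : ∀ {n} (g : Fin n → ℕ) {x y} → x ≢ y → g x + g y ≤ sum g
two-terms≤sum g {zero} {zero} x≢y = ⊥-elim (x≢y refl)
two-terms≤sum g {zero} {suc y} _ = +-monoʳ-≤ (g zero) (term≤sum (g ∘ suc) y)
two-terms≤sum g {suc x} {zero} _ =
  ≤-trans (≤-reflexive (+-comm (g (suc x)) (g zero))) (+-monoʳ-≤ (g zero) (term≤sum (g ∘ suc) x))
two-terms≤sum g {suc x} {suc y} x≢y =
  ≤-trans (two-terms≤sum (g ∘ suc) (x≢y ∘ cong suc)) (m≤n+m _ _)

sum-𝟙-unique : ∀ {n p} {P : Fin n → Set p} (P? : ∀ x → Dec (P x)) (g : Fin n → ℕ) x₀ →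
               P x₀ → (∀ x → P x → x ≡ x₀) → sum (λ x → g x * 𝟙 (P? x)) ≡ g x₀
sum-𝟙-unique P? g x₀ Px₀ unique =
  trans (sum-delta x₀ λ x x≢x₀ → trans (cong (g x *_) (𝟙-no (x≢x₀ ∘ unique x) (P? x))) (*-zeroʳ (g x)))
        (trans (cong (g x₀ *_) (𝟙-yes Px₀ (P? x₀))) (*-identityʳ (g x₀)))

sum-𝟙-none : ∀ {n p} {P : Fin n → Set p} (P? : ∀ x → Dec (P x)) (g : Fin n → ℕ) →
             (∀ x → ¬ P x) → sum (λ x → g x * 𝟙 (P? x)) ≡ 0
sum-𝟙-none P? g ∄P = sum-zero λ x → trans (cong (g x *_) (𝟙-no (∄P x) (P? x))) (*-zeroʳ (g x))

count-one : ∀ {n p} {P : Fin n → Set p} (P? : ∀ x → Dec (P x)) x₀ →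
            P x₀ → (∀ x → P x → x ≡ x₀) → sum (λ x → 𝟙 (P? x)) ≡ 1
count-one P? x₀ Px₀ unique =
  trans (sum-delta x₀ λ x x≢x₀ → 𝟙-no (x≢x₀ ∘ unique x) (P? x)) (𝟙-yes Px₀ (P? x₀))

count-none : ∀ {n p} {P : Fin n → Set p} (P? : ∀ x → Dec (P x)) → (∀ x → ¬ P x) → sum (λ x → 𝟙 (P? x)) ≡ 0
count-none P? ∄P = sum-zero λ x → 𝟙-no (∄P x) (P? x)

count-< : ∀ {n} m → m ≤ n → sum {n} (λ x → 𝟙 (toℕ x <? m)) ≡ m
count-< {n} zero _ = sum-zero {n} (λ x → 𝟙-no (λ ()) (toℕ x <? 0))
count-< {suc n} (suc m) (s≤s m≤n) =
  cong suc (trans (sum-cong-≗ {n} λ x → 𝟙-cong s≤s⁻¹ s≤s (suc (toℕ x) <? suc m) (toℕ x <? m)) (count-< m m≤n))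

count-unique≤1 : ∀ {n p} {P : Fin n → Set p} (P? : ∀ x → Dec (P x)) →
                 (∀ x y → P x → P y → x ≡ y) → sum (λ x → 𝟙 (P? x)) ≤ 1
count-unique≤1 P? unique with any? P?
... | yes (x₀ , Px₀) = ≤-reflexive (count-one P? x₀ Px₀ λ x Px → unique x x₀ Px Px₀)
... | no ∄P = ≤-trans (≤-reflexive (count-none P? λ x Px → ∄P (x , Px))) z≤n

module _ {k N} (f : Fin k → Fin N) where

  private
    onImage : (Fin N → ℕ) → Fin N → ℕ
    onImage h x = sum (λ r → h x * 𝟙 (f r Fin.≟ x))

    delta-at : (h : Fin N → ℕ) (r : Fin k) → sum (λ x → h x * 𝟙 (f r Fin.≟ x)) ≡ h (f r)
    delta-at h r = sum-𝟙-unique (f r Fin.≟_) h (f r) refl (λ _ → sym)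

    sum∘f : ∀ h → sum (h ∘ f) ≡ sum (onImage h)
    sum∘f h = trans (sym (sum-cong-≗ {k} (delta-at h))) (∑-comm (λ r x → h x * 𝟙 (f r Fin.≟ x)))

  -- That is, sum h′ ∸ sum (h′ ∘ f) ≡ sum h ∸ sum (h ∘ f), stated without truncated subtraction.
  sum-patch : Injective _≡_ _≡_ f → ∀ h h′ → (∀ x → (∀ r → f r ≢ x) → h′ x ≡ h x) →
              sum h′ + sum (h ∘ f) ≡ sum h + sum (h′ ∘ f)
  sum-patch f-inj h h′ h′≡h = begin
    sum h′ + sum (h ∘ f)                  ≡⟨ cong (sum h′ +_) (sum∘f h) ⟩
    sum h′ + sum (onImage h)                 ≡⟨ ∑-distrib-+ h′ (onImage h) ⟨
    sum (λ x → h′ x + onImage h x)           ≡⟨ sum-cong-≗ {N} pointwise ⟩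
    sum (λ x → h x + onImage h′ x)           ≡⟨ ∑-distrib-+ h (onImage h′) ⟩
    sum h + sum (onImage h′)                 ≡⟨ cong (sum h +_) (sum∘f h′) ⟨
    sum h + sum (h′ ∘ f)                  ∎
    where
    open ≡-Reasoning
    pointwise : ∀ x → h′ x + onImage h x ≡ h x + onImage h′ x
    pointwise x with any? (λ r → f r Fin.≟ x)
    ... | yes (r , refl) = trans (cong (h′ (f r) +_) (hit h)) (trans (+-comm (h′ (f r)) (h (f r))) (cong (h (f r) +_) (sym (hit h′))))
      where
      hit : ∀ g → onImage g (f r) ≡ g (f r)
      hit g = sum-𝟙-unique (λ s → f s Fin.≟ f r) (λ _ → g (f r)) r refl (λ _ → f-inj)
    ... | no ∄r = cong₂ _+_ (h′≡h x λ r fr≡x → ∄r (r , fr≡x)) (trans (miss h) (sym (miss h′)))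
      where
      miss : ∀ g → onImage g x ≡ 0
      miss g = sum-𝟙-none (λ r → f r Fin.≟ x) (λ _ → g x) (λ r fr≡x → ∄r (r , fr≡x))

-- Admissible ranks

remainder-zero : ∀ {k} a d K → a < k → a + k * d ≡ k * K → a ≡ 0 × d ≡ K
remainder-zero {k} a d K a<k eq = a≡0 , *-cancelˡ-≡ d K k (trans (cong (_+ k * d) (sym a≡0)) eq)
  where
  instance _ = >-nonZero (≤-<-trans z≤n a<k)
  a≡0 : a ≡ 0
  a≡0 = begin
    a               ≡⟨ m<n⇒m%n≡m a<k ⟨
    a % k           ≡⟨ [m+kn]%n≡m%n a d k ⟨
    (a + d * k) % k ≡⟨ cong (λ z → (a + z) % k) (*-comm d k) ⟩
    (a + k * d) % k ≡⟨ cong (_% k) (trans eq (*-comm k K)) ⟩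
    (K * k) % k     ≡⟨ m*n%n≡0 K k ⟩
    0               ∎
    where open ≡-Reasoning

-- Ranks are 0-based. The bounds on ρ count the chips smaller than the given one: at least y + 1
-- in each child left of r and y in child r; at most M left of r and y right of r.
Descends : (k M ρ r y : ℕ) → Set
Descends k M ρ r y = y * suc r + r ≤ ρ × ρ + y * r ≤ y * k + M * r × y < M

rank-sum-bounds : ∀ {k} (x : Fin k → ℕ) (r : Fin k) M →
                  (∀ a b → toℕ a ≤ toℕ b → x b ≤ x a) → (∀ a → toℕ a < toℕ r → x r < x a) → (∀ a → x a ≤ M) →
                  x r * suc (toℕ r) + toℕ r ≤ sum x × sum x + x r * toℕ r ≤ x r * k + M * toℕ r
rank-sum-bounds {suc k} x zero M antitone _ _ = lower , upper
  where
  open ≤-Reasoning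
  y = x zero
  rest = sum (x ∘ suc)
  lower : y * 1 + 0 ≤ y + rest
  lower = ≤-trans (≤-reflexive (trans (+-identityʳ _) (*-identityʳ y))) (m≤m+n y rest)
  upper : y + rest + y * 0 ≤ y * suc k + M * 0
  upper = begin
    y + rest + y * 0      ≡⟨ eq₁ y rest ⟩
    y + rest              ≤⟨ +-monoʳ-≤ y (sum-mono-≤ {k} λ a → antitone zero (suc a) z≤n) ⟩
    y + sum {k} (λ _ → y) ≡⟨ cong (y +_) (sum-const k y) ⟩
    y + k * y             ≡⟨ eq₂ y k M ⟩
    y * suc k + M * 0     ∎
    where
    eq₁ : ∀ y s → y + s + y * 0 ≡ y + s
    eq₁ = solve-∀
    eq₂ : ∀ y k M → y + k * y ≡ y * suc k + M * 0
    eq₂ = solve-∀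
rank-sum-bounds {suc k} x (suc r) M antitone left-larger ≤M = lower , upper
  where
  open ≤-Reasoning
  y = x (suc r)
  x₀ = x zero
  rest = sum (x ∘ suc)
  IH = rank-sum-bounds (x ∘ suc) r M (λ a b → antitone (suc a) (suc b) ∘ s≤s)
         (λ a → left-larger (suc a) ∘ s≤s) (≤M ∘ suc)
  lower : y * suc (suc (toℕ r)) + suc (toℕ r) ≤ x₀ + rest
  lower = begin
    y * suc (suc (toℕ r)) + suc (toℕ r) ≡⟨ eq y (toℕ r) ⟩
    (y * suc (toℕ r) + toℕ r) + suc y   ≤⟨ +-mono-≤ (proj₁ IH) (left-larger zero (s≤s z≤n)) ⟩
    rest + x₀                          ≡⟨ +-comm rest x₀ ⟩
    x₀ + rest                          ∎
    where
    eq : ∀ y r → y * suc (suc r) + suc r ≡ (y * suc r + r) + suc y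
    eq = solve-∀
  upper : x₀ + rest + y * suc (toℕ r) ≤ y * suc k + M * suc (toℕ r)
  upper = begin
    x₀ + rest + y * suc (toℕ r)        ≡⟨ eq₁ x₀ rest y (toℕ r) ⟩
    x₀ + (rest + y * toℕ r) + y        ≤⟨ +-monoˡ-≤ y (+-mono-≤ (≤M zero) (proj₂ IH)) ⟩
    M + (y * k + M * toℕ r) + y        ≡⟨ eq₂ M y k (toℕ r) ⟩
    y * suc k + M * suc (toℕ r)        ∎
    where
    eq₁ : ∀ x₀ s y r → x₀ + s + y * suc r ≡ x₀ + (s + y * r) + y
    eq₁ = solve-∀
    eq₂ : ∀ M y k r → M + (y * k + M * r) + y ≡ y * suc k + M * suc r
    eq₂ = solve-∀

descends⇒< : ∀ {k M ρ r y} → Descends k M ρ r y → r < k → ρ < M * k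
descends⇒< {k} {M} {ρ} {r} {y} (_ , upper , y<M) r<k
  with m≤n⇒∃[o]m+o≡n r<k | m≤n⇒∃[o]m+o≡n y<M
... | e , refl | g , refl = +-cancelʳ-≤ (y * r) (suc ρ) (suc (y + g) * suc (r + e)) (begin
  suc ρ + y * r                                            ≤⟨ s≤s upper ⟩
  suc (y * suc (r + e) + suc (y + g) * r)                  ≤⟨ m≤m+n _ (e + g + g * e) ⟩
  suc (y * suc (r + e) + suc (y + g) * r) + (e + g + g * e) ≡⟨ eq y g r e ⟩
  suc (y + g) * suc (r + e) + y * r                        ∎)
  where
  open ≤-Reasoning
  eq : ∀ y g r e → suc (y * suc (r + e) + suc (y + g) * r) + (e + g + g * e) ≡ suc (y + g) * suc (r + e) + y * r
  eq = solve-∀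

private
  tight-upper-bound-max : ∀ {k M ρ ρ′ r y y′} → r < k → y′ ≤ y →
                          ρ + y * r ≡ y * k + M * r → ρ′ + y′ * r ≤ y′ * k + M * r → ρ′ ≤ ρ
  tight-upper-bound-max {k} {M} {ρ} {ρ′} {r} {y} {y′} r<k y′≤y tight upper
    with m≤n⇒∃[o]m+o≡n r<k | m≤n⇒∃[o]m+o≡n y′≤y
  ... | e , refl | d , refl = begin
    ρ′                                ≤⟨ +-cancelˡ-≤ (y′ * r) ρ′ _ (≤-trans (≤-reflexive (+-comm (y′ * r) ρ′))
                                                                     (≤-trans upper (≤-reflexive (eq₁ y′ r e M)))) ⟩
    y′ * suc e + M * r                ≤⟨ +-monoˡ-≤ (M * r) (*-monoˡ-≤ (suc e) (m≤m+n y′ d)) ⟩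
    (y′ + d) * suc e + M * r          ≡⟨ +-cancelʳ-≡ ((y′ + d) * r) _ ρ (trans (eq₂ (y′ + d) r e M) (sym tight)) ⟩
    ρ                                 ∎
    where
    open ≤-Reasoning
    eq₁ : ∀ y r e M → y * suc (r + e) + M * r ≡ y * r + (y * suc e + M * r)
    eq₁ = solve-∀
    eq₂ : ∀ y r e M → y * suc e + M * r + y * r ≡ y * suc (r + e) + M * r
    eq₂ = solve-∀

  descends-next-child-rank : ∀ {k M ρ r y} → r < k → suc y < M →
                             ρ + y * r ≡ y * k + M * r → Descends k M (suc ρ) r (suc y)
  descends-next-child-rank {k} {M} {ρ} {r} {y} r<k sy<M tight
    with m≤n⇒∃[o]m+o≡n r<k | m≤n⇒∃[o]m+o≡n sy<M
  ... | e , refl | g , refl = lower , upper , s≤s (m≤m+n (suc y) g)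
    where
    open ≤-Reasoning
    ρ≡ : ρ ≡ y * suc e + suc (suc y + g) * r
    ρ≡ = +-cancelʳ-≡ (y * r) ρ _ (trans tight (eq y r e (suc (suc y + g))))
      where
      eq : ∀ y r e M → y * suc (r + e) + M * r ≡ y * suc e + M * r + y * r
      eq = solve-∀
    lower : suc y * suc r + r ≤ suc ρ
    lower = begin
      suc y * suc r + r                            ≤⟨ m≤m+n _ (y * e + g * r) ⟩
      suc y * suc r + r + (y * e + g * r)          ≡⟨ eq y r e g ⟩
      suc (y * suc e + suc (suc y + g) * r)        ≡⟨ cong suc ρ≡ ⟨
      suc ρ                                        ∎
      where
      eq : ∀ y r e g → suc y * suc r + r + (y * e + g * r) ≡ suc (y * suc e + suc (suc y + g) * r)
      eq = solve-∀
    upper : suc ρ + suc y * r ≤ suc y * suc (r + e) + suc (suc y + g) * r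
    upper = begin
      suc ρ + suc y * r                                         ≡⟨ cong (λ z → suc z + suc y * r) ρ≡ ⟩
      suc (y * suc e + suc (suc y + g) * r) + suc y * r         ≤⟨ m≤m+n _ e ⟩
      suc (y * suc e + suc (suc y + g) * r) + suc y * r + e     ≡⟨ eq y r e g ⟩
      suc y * suc (r + e) + suc (suc y + g) * r                 ∎
      where
      eq : ∀ y r e g → suc (y * suc e + suc (suc y + g) * r) + suc y * r + e ≡ suc y * suc (r + e) + suc (suc y + g) * r
      eq = solve-∀

descends-suc : ∀ {k M ρ ρ′ r y y′} → Descends k M ρ r y → Descends k M ρ′ r y′ → ρ < ρ′ → r < k →
               Descends k M (suc ρ) r y ⊎ (Descends k M (suc ρ) r (suc y) × suc y ≤ y′)
descends-suc {k} {M} {ρ} {ρ′} {r} {y} {y′} (lower , upper , y<M) (_ , upper′ , y′<M) ρ<ρ′ r<k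
  with suc ρ + y * r ≤? y * k + M * r
... | yes upper-suc = inj₁ (m≤n⇒m≤1+n lower , upper-suc , y<M)
... | no ¬upper-suc = inj₂ (descends-next-child-rank r<k (<-≤-trans (s≤s y<y′) y′<M) tight , y<y′)
  where
  tight : ρ + y * r ≡ y * k + M * r
  tight = ≤-antisym upper (≮⇒≥ ¬upper-suc)
  y<y′ : y < y′
  y<y′ with y <? y′
  ... | yes y<y′ = y<y′
  ... | no y≮y′ = ⊥-elim (<⇒≱ ρ<ρ′ (tight-upper-bound-max {M = M} r<k (≮⇒≥ y≮y′) tight upper′))

-- Firing k chips at a vertex holding (M + 2) k chips: the j smallest of them are smaller than the
-- chip of rank ρ, which keeps its target child r; that child then gets one smaller chip iff r < j.
descends-peel : ∀ {k M ρ r y} → Descends k (suc (suc M)) ρ r y → r < k →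
                ∃ λ j → ∃ λ ρ′ → ∃ λ y′ → j ≤ k × ρ ≡ j + ρ′ × Descends k (suc M) ρ′ r y′ ×
                  (r < j × y ≡ suc y′ ⊎ j ≤ r × y ≡ y′)
descends-peel {k} {M} {ρ} {r} {zero} (lower , upper , _) r<k with ρ ≤? suc M * r
... | yes ρ≤ = 0 , ρ , 0 , z≤n , refl , (lower , ≤-trans (≤-reflexive (+-identityʳ ρ)) ρ≤ , s≤s z≤n) , inj₂ (z≤n , refl)
... | no ρ≰ with m≤n⇒∃[o]m+o≡n (<⇒≤ (≰⇒> ρ≰))
...   | j , refl = j , suc M * r , 0 , ≤-trans j≤r (<⇒≤ r<k) , +-comm (suc M * r) j ,
                   (m≤m+n r (M * r) , ≤-reflexive (+-identityʳ _) , s≤s z≤n) , inj₂ (j≤r , refl)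
  where
  j≤r : j ≤ r
  j≤r = +-cancelˡ-≤ (suc M * r) j r
          (≤-trans (≤-reflexive (sym (+-identityʳ _))) (≤-trans upper (≤-reflexive (+-comm r (suc M * r)))))
descends-peel {k} {M} {ρ} {r} {suc y} (lower , upper , y<M) r<k
  with m≤n⇒∃[o]m+o≡n r<k | m≤n⇒∃[o]m+o≡n lower | m≤n⇒∃[o]m+o≡n upper
... | e , refl | t , refl | s , slack with e ≤? s
...   | yes e≤s = one-row (m≤n⇒∃[o]m+o≡n e≤s)
  where
  one-row : ∃ (λ o → e + o ≡ s) → _
  one-row (o , refl) = suc r , ρ′ , y , m≤m+n (suc r) e , eq₁ y r t ,
                       (m≤m+n _ t , m+n≤o⇒m≤o _ (≤-reflexive upper′) , ≤-pred y<M) , inj₁ (≤-refl , refl)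
    where
    ρ′ = y * suc r + r + t
    upper′ : ρ′ + y * r + o ≡ y * suc (r + e) + suc M * r
    upper′ = +-cancelʳ-≡ (suc r + r + e) _ _ (begin
      ρ′ + y * r + o + (suc r + r + e)                    ≡⟨ eq₂ y r t e o ⟩
      (suc y * suc r + r + t + suc y * r) + (e + o)       ≡⟨ slack ⟩
      suc y * suc (r + e) + suc (suc M) * r              ≡⟨ eq₃ y r e M ⟩
      y * suc (r + e) + suc M * r + (suc r + r + e)       ∎)
      where
      open ≡-Reasoning
      eq₂ : ∀ y r t e o → y * suc r + r + t + y * r + o + (suc r + r + e) ≡ (suc y * suc r + r + t + suc y * r) + (e + o)
      eq₂ = solve-∀
      eq₃ : ∀ y r e M → suc y * suc (r + e) + suc (suc M) * r ≡ y * suc (r + e) + suc M * r + (suc r + r + e)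
      eq₃ = solve-∀
    eq₁ : ∀ y r t → suc y * suc r + r + t ≡ suc r + (y * suc r + r + t)
    eq₁ = solve-∀
...   | no e≰s = wider-row (m≤n⇒∃[o]m+o≡n (≰⇒> e≰s)) (m≤n⇒∃[o]m+o≡n (≤-pred (≤-pred y<M)))
  where
  wider-row : ∃ (λ q → suc s + q ≡ e) → ∃ (λ h → y + h ≡ M) → _
  wider-row (q , refl) (h , refl) =
    suc r + suc q , ρ′ , y , m+n≤o⇒m≤o _ (≤-reflexive (eq₁ r q s)) , ρ≡ ,
    (m+n≤o⇒m≤o _ (≤-reflexive (eq₂ y r s q h)) , ≤-reflexive (eq₃ y r s q h) , s≤s (m≤m+n y h)) ,
    inj₁ (s≤s (m≤m+n r (suc q)) , refl)
    where
    ρ′ = y * suc (suc (s + q)) + suc (y + h) * r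
    eq₁ : ∀ r q s → suc r + suc q + s ≡ suc (r + suc (s + q))
    eq₁ = solve-∀
    eq₂ : ∀ y r s q h → y * suc r + r + (y * suc (s + q) + h * r) ≡ y * suc (suc (s + q)) + suc (y + h) * r
    eq₂ = solve-∀
    eq₃ : ∀ y r s q h → y * suc (suc (s + q)) + suc (y + h) * r + y * r ≡ y * suc (r + suc (s + q)) + suc (y + h) * r
    eq₃ = solve-∀
    ρ≡ : suc y * suc r + r + t ≡ suc r + suc q + ρ′
    ρ≡ = +-cancelʳ-≡ (suc y * r + s) _ _ (begin
      suc y * suc r + r + t + (suc y * r + s)                   ≡⟨ +-assoc (suc y * suc r + r + t) _ s ⟨
      suc y * suc r + r + t + suc y * r + s                     ≡⟨ slack ⟩
      suc y * suc (r + suc (s + q)) + suc (suc (y + h)) * r     ≡⟨ eq₄ y r s q h ⟩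
      suc r + suc q + ρ′ + (suc y * r + s)                      ∎)
      where
      open ≡-Reasoning
      eq₄ : ∀ y r s q h → suc y * suc (r + suc (s + q)) + suc (suc (y + h)) * r
                          ≡ suc r + suc q + (y * suc (suc (s + q)) + suc (y + h) * r) + (suc y * r + s)
      eq₄ = solve-∀

module _ {k : ℕ} where

  -- Lands m u ρ: among k ^ m chips on a vertex, the one of (0-based) rank ρ can end at the
  -- descendant reached by u.
  Lands : ℕ → List (Fin k) → ℕ → Set
  Lands zero [] ρ = ρ ≡ 0
  Lands zero (_ ∷ _) ρ = ⊥
  Lands (suc m) [] ρ = ⊥
  Lands (suc m) (r ∷ u) ρ = ∃ λ y → Descends k (k ^ m) ρ (toℕ r) y × Lands m u y

  lands-suc : ∀ m u {ρ ρ′} → Lands m u ρ → Lands m u ρ′ → ρ < ρ′ → Lands m u (suc ρ)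
  lands-suc zero [] refl refl ()
  lands-suc (suc m) (r ∷ u) (y , ρ↓y , y-lands) (y′ , ρ′↓y′ , y′-lands) ρ<ρ′
    with descends-suc ρ↓y ρ′↓y′ ρ<ρ′ (toℕ<n r)
  ... | inj₁ sρ↓y = y , sρ↓y , y-lands
  ... | inj₂ (sρ↓sy , y<y′) = suc y , sρ↓sy , lands-suc m u y-lands y′-lands y<y′

  lands-interval : ∀ m u {ρ₁ ρ₂ ρ} → Lands m u ρ₁ → Lands m u ρ₂ → ρ₁ ≤ ρ → ρ ≤ ρ₂ → Lands m u ρ
  lands-interval m u {ρ₁} {ρ₂} ρ₁-lands ρ₂-lands ρ₁≤ρ ρ≤ρ₂ with m≤n⇒∃[o]m+o≡n ρ₁≤ρ
  ... | d , refl = go d ρ≤ρ₂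
    where
    go : ∀ d → ρ₁ + d ≤ ρ₂ → Lands m u (ρ₁ + d)
    go zero _ = subst (Lands m u) (sym (+-identityʳ ρ₁)) ρ₁-lands
    go (suc d) ≤ρ₂ = subst (Lands m u) (sym (+-suc ρ₁ d))
      (lands-suc m u (go d (≤-trans (+-monoʳ-≤ ρ₁ (n≤1+n d)) ≤ρ₂)) ρ₂-lands
                     (≤-trans (≤-reflexive (sym (+-suc ρ₁ d))) ≤ρ₂))

module _ {k : ℕ} where

  _≟ᵥ_ : DecidableEquality (Vertex k)
  _≟ᵥ_ = ≡-dec Fin._≟_

  _≼_ : Vertex k → Vertex k → Set
  a ≼ u = ∃ λ z → a ++ z ≡ u

  _≼?_ : (a u : Vertex k) → Dec (a ≼ u)
  [] ≼? u = yes (u , refl)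
  (x ∷ a) ≼? [] = no λ { (z , ()) }
  (x ∷ a) ≼? (y ∷ u) with x Fin.≟ y | a ≼? u
  ... | yes refl | yes (z , a++z≡u) = yes (z , cong (x ∷_) a++z≡u)
  ... | yes refl | no a⋠u = no λ { (z , eq) → a⋠u (z , ∷-injectiveʳ eq) }
  ... | no x≢y | _ = no λ { (z , eq) → x≢y (∷-injectiveˡ eq) }

  ≼⇒length≤ : ∀ {a u} → a ≼ u → length a ≤ length u
  ≼⇒length≤ {a} (z , refl) = length-++-≤ˡ a

  length-∷ʳ : ∀ (w : Vertex k) r → length (w ∷ʳ r) ≡ suc (length w)
  length-∷ʳ w r = trans (length-++ w) (+-comm (length w) 1)

  child⋠parent : ∀ (w : Vertex k) r → ¬ (w ∷ʳ r) ≼ w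
  child⋠parent w r ≼w = 1+n≰n (≤-trans (≤-reflexive (sym (length-∷ʳ w r))) (≼⇒length≤ ≼w))

  child≢parent : ∀ (w : Vertex k) r → w ∷ʳ r ≢ w
  child≢parent w r eq = child⋠parent w r ([] , trans (++-identityʳ _) eq)

  ≼-∷ʳ : ∀ {a w : Vertex k} r → a ≼ w → a ≼ (w ∷ʳ r)
  ≼-∷ʳ {a} r (z , refl) = z ∷ʳ r , sym (++-assoc a z (r ∷ []))

  ≼-∷ʳ⁻ : ∀ {a w : Vertex k} r → a ≼ (w ∷ʳ r) → a ≼ w ⊎ a ≡ w ∷ʳ r
  ≼-∷ʳ⁻ {[]} {w} r _ = inj₁ (w , refl)
  ≼-∷ʳ⁻ {x ∷ a} {[]} r (z , eq) = inj₂ (cong₂ _∷_ (∷-injectiveˡ eq) (++-conicalˡ a z (∷-injectiveʳ eq)))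
  ≼-∷ʳ⁻ {x ∷ a} {y ∷ w} r (z , eq) with ≼-∷ʳ⁻ r (z , ∷-injectiveʳ eq)
  ... | inj₁ (z′ , eq′) = inj₁ (z′ , cong₂ _∷_ (∷-injectiveˡ eq) eq′)
  ... | inj₂ eq′ = inj₂ (cong₂ _∷_ (∷-injectiveˡ eq) eq′)

  ++-cancelˡ-∷ : ∀ (p : Vertex k) {a b w w′} → p ++ (a ∷ w) ≡ p ++ (b ∷ w′) → a ≡ b × w ≡ w′
  ++-cancelˡ-∷ p eq with ++-cancelˡ p _ _ eq
  ... | refl = refl , refl

  𝟙-≼-∷ʳ : ∀ (a w : Vertex k) r → 𝟙 (a ≼? (w ∷ʳ r)) ≡ 𝟙 (a ≼? w) + 𝟙 (a ≟ᵥ (w ∷ʳ r))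
  𝟙-≼-∷ʳ a w r with a ≼? w
  ... | yes a≼w = trans (𝟙-yes (≼-∷ʳ r a≼w) (a ≼? (w ∷ʳ r)))
                        (cong suc (sym (𝟙-no (λ { refl → child⋠parent w r a≼w }) (a ≟ᵥ (w ∷ʳ r)))))
  ... | no a⋠w = 𝟙-cong (λ a≼ → [ (λ a≼w → ⊥-elim (a⋠w a≼w)) , (λ eq → eq) ]′ (≼-∷ʳ⁻ r a≼))
                        (λ { refl → [] , ++-identityʳ a }) (a ≼? (w ∷ʳ r)) (a ≟ᵥ (w ∷ʳ r))

  𝟙-≼-children : ∀ (v w : Vertex k) → 𝟙 (v ≼? w) ≡ 𝟙 (w ≟ᵥ v) + sum (λ j → 𝟙 ((v ∷ʳ j) ≼? w))
  𝟙-≼-children v w with v ≼? w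
  ... | no v⋠w = sym (cong₂ _+_ (𝟙-no (λ { refl → v⋠w ([] , ++-identityʳ v) }) (w ≟ᵥ v))
                                (count-none (λ j → (v ∷ʳ j) ≼? w) λ j → v⋠w ∘ child≼⇒≼ j))
    where
    child≼⇒≼ : ∀ j → (v ∷ʳ j) ≼ w → v ≼ w
    child≼⇒≼ j (z , eq) = j ∷ z , trans (sym (∷ʳ-++ v j z)) eq
  ... | yes ([] , refl) = sym (cong₂ _+_ (𝟙-yes (++-identityʳ v) ((v ++ []) ≟ᵥ v))
                                        (count-none (λ j → (v ∷ʳ j) ≼? (v ++ []))
                                          λ j → child⋠parent v j ∘ subst ((v ∷ʳ j) ≼_) (++-identityʳ v)))
  ... | yes (j₀ ∷ z , refl) = sym (cong₂ _+_ (𝟙-no longer≢ ((v ++ j₀ ∷ z) ≟ᵥ v))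
                                            (count-one (λ j → (v ∷ʳ j) ≼? (v ++ j₀ ∷ z)) j₀ (z , ∷ʳ-++ v j₀ z) only-j₀))
    where
    longer≢ : v ++ j₀ ∷ z ≢ v
    longer≢ eq = child⋠parent v j₀ (z , trans (∷ʳ-++ v j₀ z) eq)
    only-j₀ : ∀ j → (v ∷ʳ j) ≼ (v ++ j₀ ∷ z) → j ≡ j₀
    only-j₀ j (z′ , eq) = proj₁ (++-cancelˡ-∷ v (trans (sym (∷ʳ-++ v j z′)) eq))

module _ {k N : ℕ} where

  weight : (Fin N → ℕ) → (Vertex k → ℕ) → Config k N → ℕ
  weight g χ C = sum (λ x → g x * χ (C x))

  weightAt : (Fin N → ℕ) → Vertex k → Config k N → ℕ
  weightAt g a = weight g (λ u → 𝟙 (u ≟ᵥ a))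

  weightBelow : (Fin N → ℕ) → Vertex k → Config k N → ℕ
  weightBelow g a = weight g (λ u → 𝟙 (a ≼? u))

  weightBelow-children : ∀ g v (C : Config k N) → weightBelow g v C ≡ weightAt g v C + sum (λ j → weightBelow g (v ∷ʳ j) C)
  weightBelow-children g v C = begin
    weightBelow g v C
      ≡⟨ sum-cong-≗ {N} (λ x → trans (cong (g x *_) (𝟙-≼-children v (C x))) (*-distribˡ-+ (g x) _ _)) ⟩
    sum (λ x → g x * 𝟙 (C x ≟ᵥ v) + g x * sum (λ j → 𝟙 ((v ∷ʳ j) ≼? C x)))
      ≡⟨ ∑-distrib-+ (λ x → g x * 𝟙 (C x ≟ᵥ v)) _ ⟩
    weightAt g v C + sum (λ x → g x * sum (λ j → 𝟙 ((v ∷ʳ j) ≼? C x)))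
      ≡⟨ cong (weightAt g v C +_) (sum-cong-≗ {N} λ x → *-distribˡ-sum (g x) (λ j → 𝟙 ((v ∷ʳ j) ≼? C x))) ⟩
    weightAt g v C + sum (λ x → sum (λ j → g x * 𝟙 ((v ∷ʳ j) ≼? C x)))
      ≡⟨ cong (weightAt g v C +_) (∑-comm (λ x j → g x * 𝟙 ((v ∷ʳ j) ≼? C x))) ⟩
    weightAt g v C + sum (λ j → weightBelow g (v ∷ʳ j) C) ∎
    where open ≡-Reasoning

  increasing⇒injective : ∀ {f : Fin k → Fin N} → StrictlyIncreasing f → Injective _≡_ _≡_ f
  increasing⇒injective {f} increasing {r} {s} fr≡fs with Finₚ.<-cmp r s
  ... | tri< r<s _ _ = ⊥-elim (<-irrefl (cong toℕ fr≡fs) (increasing r s r<s))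
  ... | tri≈ _ r≡s _ = r≡s
  ... | tri> _ _ s<r = ⊥-elim (<-irrefl (cong toℕ (sym fr≡fs)) (increasing s r s<r))

  module Firing (C : Config k N) (v : Vertex k) (f : Fin k → Fin N)
                (f-inj : Injective _≡_ _≡_ f) (on-v : ∀ r → C (f r) ≡ v) where

    C′ : Config k N
    C′ = fireAt C v f

    fired : ∀ r → C′ (f r) ≡ v ∷ʳ r
    fired r with any? (λ r′ → f r′ Fin.≟ f r)
    ... | yes (r′ , fr′≡fr) = cong (v ∷ʳ_) (f-inj fr′≡fr)
    ... | no ∄r′ = ⊥-elim (∄r′ (r , refl))

    unfired : ∀ x → (∀ r → f r ≢ x) → C′ x ≡ C x
    unfired x ∄r with any? (λ r′ → f r′ Fin.≟ x)
    ... | yes (r′ , fr′≡x) = ⊥-elim (∄r r′ fr′≡x)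
    ... | no _ = refl

    weight-fire : ∀ g χ → weight g χ C′ + sum (λ r → g (f r) * χ v) ≡ weight g χ C + sum (λ r → g (f r) * χ (v ∷ʳ r))
    weight-fire g χ = begin
      weight g χ C′ + sum (λ r → g (f r) * χ v)
        ≡⟨ cong (weight g χ C′ +_) (sum-cong-≗ {k} λ r → cong (λ u → g (f r) * χ u) (sym (on-v r))) ⟩
      weight g χ C′ + sum (λ r → g (f r) * χ (C (f r)))
        ≡⟨ sum-patch f f-inj (λ x → g x * χ (C x)) (λ x → g x * χ (C′ x)) (λ x ∄r → cong (λ u → g x * χ u) (unfired x ∄r)) ⟩
      weight g χ C + sum (λ r → g (f r) * χ (C′ (f r)))
        ≡⟨ cong (weight g χ C +_) (sum-cong-≗ {k} λ r → cong (λ u → g (f r) * χ u) (fired r)) ⟩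
      weight g χ C + sum (λ r → g (f r) * χ (v ∷ʳ r))
        ∎
      where open ≡-Reasoning

    weightAt-fired : ∀ g → weightAt g v C′ + sum (g ∘ f) ≡ weightAt g v C
    weightAt-fired g = begin
      weightAt g v C′ + sum (g ∘ f)
        ≡⟨ cong (weightAt g v C′ +_) (sum-cong-≗ {k} λ r → sym (at-v r)) ⟩
      weightAt g v C′ + sum (λ r → g (f r) * 𝟙 (v ≟ᵥ v))
        ≡⟨ weight-fire g (λ u → 𝟙 (u ≟ᵥ v)) ⟩
      weightAt g v C + sum (λ r → g (f r) * 𝟙 ((v ∷ʳ r) ≟ᵥ v))
        ≡⟨ cong (weightAt g v C +_) (sum-𝟙-none (λ r → (v ∷ʳ r) ≟ᵥ v) (g ∘ f) (child≢parent v)) ⟩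
      weightAt g v C + 0
        ≡⟨ +-identityʳ _ ⟩
      weightAt g v C
        ∎
      where
      open ≡-Reasoning
      at-v : ∀ r → g (f r) * 𝟙 (v ≟ᵥ v) ≡ g (f r)
      at-v r = trans (cong (g (f r) *_) (𝟙-yes refl (v ≟ᵥ v))) (*-identityʳ _)

    weightAt-child : ∀ g s → weightAt g (v ∷ʳ s) C′ ≡ weightAt g (v ∷ʳ s) C + g (f s)
    weightAt-child g s = begin
      weightAt g (v ∷ʳ s) C′
        ≡⟨ +-identityʳ _ ⟨
      weightAt g (v ∷ʳ s) C′ + 0
        ≡⟨ cong (weightAt g (v ∷ʳ s) C′ +_) (sum-𝟙-none (λ _ → v ≟ᵥ (v ∷ʳ s)) (g ∘ f) (λ _ → child≢parent v s ∘ sym)) ⟨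
      weightAt g (v ∷ʳ s) C′ + sum (λ r → g (f r) * 𝟙 (v ≟ᵥ (v ∷ʳ s)))
        ≡⟨ weight-fire g (λ u → 𝟙 (u ≟ᵥ (v ∷ʳ s))) ⟩
      weightAt g (v ∷ʳ s) C + sum (λ r → g (f r) * 𝟙 ((v ∷ʳ r) ≟ᵥ (v ∷ʳ s)))
        ≡⟨ cong (weightAt g (v ∷ʳ s) C +_)
                (sum-𝟙-unique (λ r → (v ∷ʳ r) ≟ᵥ (v ∷ʳ s)) (g ∘ f) s refl (λ r → proj₂ ∘ ∷ʳ-injective v v)) ⟩
      weightAt g (v ∷ʳ s) C + g (f s)
        ∎
      where open ≡-Reasoning

    weightBelow-fire : ∀ g a → weightBelow g a C′ ≡ weightBelow g a C + sum (λ r → g (f r) * 𝟙 (a ≟ᵥ (v ∷ʳ r)))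
    weightBelow-fire g a = +-cancelʳ-≡ S _ _ (begin
      weightBelow g a C′ + S
        ≡⟨ weight-fire g (λ u → 𝟙 (a ≼? u)) ⟩
      weightBelow g a C + sum (λ r → g (f r) * 𝟙 (a ≼? (v ∷ʳ r)))
        ≡⟨ cong (weightBelow g a C +_) (sum-cong-≗ {k} λ r → trans (cong (g (f r) *_) (𝟙-≼-∷ʳ a v r)) (*-distribˡ-+ (g (f r)) _ _)) ⟩
      weightBelow g a C + sum (λ r → g (f r) * 𝟙 (a ≼? v) + g (f r) * 𝟙 (a ≟ᵥ (v ∷ʳ r)))
        ≡⟨ cong (weightBelow g a C +_) (∑-distrib-+ (λ r → g (f r) * 𝟙 (a ≼? v)) _) ⟩
      weightBelow g a C + (S + E)
        ≡⟨ cong (weightBelow g a C +_) (+-comm S E) ⟩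
      weightBelow g a C + (E + S)
        ≡⟨ +-assoc (weightBelow g a C) E S ⟨
      weightBelow g a C + E + S
        ∎)
      where
      open ≡-Reasoning
      S = sum (λ r → g (f r) * 𝟙 (a ≼? v))
      E = sum (λ r → g (f r) * 𝟙 (a ≟ᵥ (v ∷ʳ r)))

    weightBelow-∷ʳ : ∀ g u j → weightBelow g (u ∷ʳ j) C′ ≡ weightBelow g (u ∷ʳ j) C + 𝟙 (u ≟ᵥ v) * g (f j)
    weightBelow-∷ʳ g u j = trans (weightBelow-fire g (u ∷ʳ j)) (cong (weightBelow g (u ∷ʳ j) C +_) (added (u ≟ᵥ v)))
      where
      added : (d : Dec (u ≡ v)) → sum (λ r → g (f r) * 𝟙 ((u ∷ʳ j) ≟ᵥ (v ∷ʳ r))) ≡ 𝟙 d * g (f j)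
      added (yes refl) =
        trans (sum-𝟙-unique (λ r → (u ∷ʳ j) ≟ᵥ (u ∷ʳ r)) (g ∘ f) j refl (λ r → sym ∘ proj₂ ∘ ∷ʳ-injective u u))
              (sym (+-identityʳ _))
      added (no u≢v) = sum-𝟙-none (λ r → (u ∷ʳ j) ≟ᵥ (v ∷ʳ r)) (g ∘ f) (λ r → u≢v ∘ proj₁ ∘ ∷ʳ-injective u v)

-- Ranks in a reachable stable configuration are admissible

length-filter-tabulate : ∀ {a p} {A : Set a} {P : Pred A p} (P? : Decidable P) {n} (h : Fin n → A) →
                         length (filter P? (tabulate h)) ≡ sum (λ x → 𝟙 (P? (h x)))
length-filter-tabulate P? {zero} h = refl
length-filter-tabulate P? {suc n} h with P? (h zero)
... | yes _ = cong suc (length-filter-tabulate P? (h ∘ suc))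
... | no _ = length-filter-tabulate P? (h ∘ suc)

module _ {N : ℕ} where

  one : Fin N → ℕ
  one _ = 1

  smaller : Fin N → Fin N → ℕ
  smaller c x = 𝟙 (toℕ x <? toℕ c)

  smaller-irrefl : ∀ c → smaller c c ≡ 0
  smaller-irrefl c = 𝟙-no (<-irrefl refl) (toℕ c <? toℕ c)

  smaller≤1 : ∀ c x → smaller c x ≤ 1
  smaller≤1 c x = 𝟙≤1 (toℕ x <? toℕ c)

  smaller-mono : ∀ {c c′} → toℕ c ≤ toℕ c′ → ∀ x → smaller c x ≤ smaller c′ x
  smaller-mono {c} {c′} c≤c′ x = 𝟙-mono (λ x<c → <-≤-trans x<c c≤c′) (toℕ x <? toℕ c) (toℕ x <? toℕ c′)

  weighted-rank< : ∀ (χ : Fin N → ℕ) {c} {g : Fin N → ℕ} → χ c ≡ 1 → (∀ x → smaller c x ≤ g x) → smaller c c < g c →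
                   sum (λ x → smaller c x * χ x) < sum (λ x → g x * χ x)
  weighted-rank< χ {c} {g} χc≡1 ≤g <g = sum-mono-< (λ x → *-monoˡ-≤ (χ x) (≤g x)) c
    (subst (λ z → smaller c c * z < g c * z) (sym χc≡1) (*-monoˡ-< 1 <g))

module _ {k N : ℕ} where

  countAt : Vertex k → Config k N → ℕ
  countAt = weightAt one

  rankAt : Fin N → Vertex k → Config k N → ℕ
  rankAt c = weightAt (smaller c)

  countBelow : Vertex k → Config k N → ℕ
  countBelow = weightBelow one

  rankBelow : Fin N → Vertex k → Config k N → ℕ
  rankBelow c = weightBelow (smaller c)

  chipsAt≡countAt : ∀ (C : Config k N) v → chipsAt C v ≡ countAt v C
  chipsAt≡countAt C v = trans (length-filter-tabulate (λ x → C x ≟ᵥ v) id) (sum-cong-≗ {N} λ x → sym (+-identityʳ _))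

  rankBelow<countBelow : ∀ (C : Config k N) c a → a ≼ C c → rankBelow c a C < countBelow a C
  rankBelow<countBelow C c a a≼ =
    weighted-rank< (λ x → 𝟙 (a ≼? C x)) (𝟙-yes a≼ (a ≼? C c)) (smaller≤1 c) (≤-reflexive (cong suc (smaller-irrefl c)))

  record Balanced (C : Config k N) : Set where
    field
      equal-sizes   : ∀ v j j′ → countBelow (v ∷ʳ j) C ≡ countBelow (v ∷ʳ j′) C
      rank-antitone : ∀ v c (a b : Fin k) → toℕ a ≤ toℕ b → rankBelow c (v ∷ʳ b) C ≤ rankBelow c (v ∷ʳ a) C
      rank-strict   : ∀ v c (r a : Fin k) → (v ∷ʳ r) ≼ C c → toℕ a < toℕ r →
                      rankBelow c (v ∷ʳ r) C < rankBelow c (v ∷ʳ a) C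
  open Balanced

  balanced-initial : Balanced initial
  balanced-initial = record
    { equal-sizes = λ v j j′ → trans (empty one v j) (sym (empty one v j′))
    ; rank-antitone = λ v c a b _ → ≤-reflexive (trans (empty (smaller c) v b) (sym (empty (smaller c) v a)))
    ; rank-strict = λ v c r a ≼[] _ → ⊥-elim (nonempty v r ≼[]) }
    where
    nonempty : ∀ v j → ¬ (v ∷ʳ j) ≼ []
    nonempty v j ≼[] with ≤-trans (≤-reflexive (sym (length-∷ʳ v j))) (≼⇒length≤ ≼[])
    ... | ()
    empty : ∀ g v j → weightBelow g (v ∷ʳ j) initial ≡ 0
    empty g v j = sum-𝟙-none (λ _ → (v ∷ʳ j) ≼? []) g (λ _ → nonempty v j)

  balanced-step : ∀ {C D} → Balanced C → Step C D → Balanced D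
  balanced-step {C} B (fire w f increasing on-w) = record
    { equal-sizes = sizes ; rank-antitone = antitone ; rank-strict = strict-after }
    where
    open Firing C w f (increasing⇒injective increasing) on-w
    open ≤-Reasoning

    f-mono : ∀ {a b} → toℕ a ≤ toℕ b → toℕ (f a) ≤ toℕ (f b)
    f-mono {a} {b} a≤b with m≤n⇒m<n∨m≡n a≤b
    ... | inj₁ a<b = <⇒≤ (increasing a b a<b)
    ... | inj₂ a≡b = ≤-reflexive (cong (toℕ ∘ f) (toℕ-injective a≡b))

    at-w : ∀ x → 𝟙 (w ≟ᵥ w) * x ≡ x
    at-w x = trans (cong (_* x) (𝟙-yes refl (w ≟ᵥ w))) (+-identityʳ x)

    sizes : ∀ v j j′ → countBelow (v ∷ʳ j) C′ ≡ countBelow (v ∷ʳ j′) C′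
    sizes v j j′ = begin-equality
      countBelow (v ∷ʳ j) C′                    ≡⟨ weightBelow-∷ʳ one v j ⟩
      countBelow (v ∷ʳ j) C + 𝟙 (v ≟ᵥ w) * 1   ≡⟨ cong (_+ 𝟙 (v ≟ᵥ w) * 1) (equal-sizes B v j j′) ⟩
      countBelow (v ∷ʳ j′) C + 𝟙 (v ≟ᵥ w) * 1  ≡⟨ weightBelow-∷ʳ one v j′ ⟨
      countBelow (v ∷ʳ j′) C′                   ∎

    antitone : ∀ v c (a b : Fin k) → toℕ a ≤ toℕ b → rankBelow c (v ∷ʳ b) C′ ≤ rankBelow c (v ∷ʳ a) C′
    antitone v c a b a≤b = begin
      rankBelow c (v ∷ʳ b) C′                             ≡⟨ weightBelow-∷ʳ (smaller c) v b ⟩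
      rankBelow c (v ∷ʳ b) C + 𝟙 (v ≟ᵥ w) * smaller c (f b) ≤⟨ +-mono-≤ (rank-antitone B v c a b a≤b)
                                                               (*-monoʳ-≤ (𝟙 (v ≟ᵥ w)) (𝟙-mono (≤-<-trans (f-mono a≤b)) _ _)) ⟩
      rankBelow c (v ∷ʳ a) C + 𝟙 (v ≟ᵥ w) * smaller c (f a) ≡⟨ weightBelow-∷ʳ (smaller c) v a ⟨
      rankBelow c (v ∷ʳ a) C′                             ∎

    strict-before : ∀ v c (r a : Fin k) → (v ∷ʳ r) ≼ C c → toℕ a < toℕ r →
                    rankBelow c (v ∷ʳ r) C′ < rankBelow c (v ∷ʳ a) C′
    strict-before v c r a ≼c a<r = begin-strict
      rankBelow c (v ∷ʳ r) C′                             ≡⟨ weightBelow-∷ʳ (smaller c) v r ⟩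
      rankBelow c (v ∷ʳ r) C + 𝟙 (v ≟ᵥ w) * smaller c (f r) <⟨ +-mono-<-≤ (rank-strict B v c r a ≼c a<r)
                                                               (*-monoʳ-≤ (𝟙 (v ≟ᵥ w)) (𝟙-mono (<-trans (increasing a r a<r)) _ _)) ⟩
      rankBelow c (v ∷ʳ a) C + 𝟙 (v ≟ᵥ w) * smaller c (f a) ≡⟨ weightBelow-∷ʳ (smaller c) v a ⟨
      rankBelow c (v ∷ʳ a) C′                             ∎

    strict-after : ∀ v c (r a : Fin k) → (v ∷ʳ r) ≼ C′ c → toℕ a < toℕ r →
             rankBelow c (v ∷ʳ r) C′ < rankBelow c (v ∷ʳ a) C′
    strict-after v c r a ≼c a<r with any? (λ r′ → c Fin.≟ f r′)
    ... | no ∄r′ = strict-before v c r a (subst ((v ∷ʳ r) ≼_) (unfired c λ r′ e → ∄r′ (r′ , sym e)) ≼c) a<r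
    ... | yes (r′ , refl) with ≼-∷ʳ⁻ r′ (subst ((v ∷ʳ r) ≼_) (fired r′) ≼c)
    ...   | inj₁ ≼w = strict-before v (f r′) r a (subst ((v ∷ʳ r) ≼_) (sym (on-w r′)) ≼w) a<r
    ...   | inj₂ eq with ∷ʳ-injective v w eq
    ...     | refl , refl = begin-strict
      rankBelow (f r) (w ∷ʳ r) C′                                 ≡⟨ weightBelow-∷ʳ (smaller (f r)) w r ⟩
      rankBelow (f r) (w ∷ʳ r) C + 𝟙 (w ≟ᵥ w) * smaller (f r) (f r) ≡⟨ cong (rankBelow (f r) (w ∷ʳ r) C +_) (trans (at-w _) (smaller-irrefl (f r))) ⟩
      rankBelow (f r) (w ∷ʳ r) C + 0                             <⟨ +-mono-≤-< (rank-antitone B w (f r) a r (<⇒≤ a<r)) ≤-refl ⟩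
      rankBelow (f r) (w ∷ʳ a) C + 1                             ≡⟨ cong (rankBelow (f r) (w ∷ʳ a) C +_)
                                                                      (trans (at-w _) (𝟙-yes (increasing a r a<r) _)) ⟨
      rankBelow (f r) (w ∷ʳ a) C + 𝟙 (w ≟ᵥ w) * smaller (f r) (f a) ≡⟨ weightBelow-∷ʳ (smaller (f r)) w a ⟨
      rankBelow (f r) (w ∷ʳ a) C′                                 ∎

  balanced-reachable : ∀ {C} → Star Step initial C → Balanced C
  balanced-reachable = go balanced-initial
    where
    go : ∀ {C D} → Balanced C → Star Step C D → Balanced D
    go B ε = B
    go B (step ◅ steps) = go (balanced-step B step) steps

  -- A stable vertex holds fewer than k chips, so a multiple of k chips in its subtree all lie strictly below it.
  stable-split : ∀ {C : Config k N} → Balanced C → Stable C → ∀ p K → countBelow p C ≡ k * K →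
                 countAt p C ≡ 0 × (∀ j → countBelow (p ∷ʳ j) C ≡ K)
  stable-split {C} B stable p K count≡ = proj₁ (split (Fin.fromℕ< (≤-<-trans z≤n at-p<k))) , proj₂ ∘ split
    where
    at-p<k : countAt p C < k
    at-p<k = subst (_< k) (chipsAt≡countAt C p) (stable p)
    total : ∀ r → countAt p C + k * countBelow (p ∷ʳ r) C ≡ k * K
    total r = begin
      countAt p C + k * countBelow (p ∷ʳ r) C             ≡⟨ cong (countAt p C +_) (sum-const k _) ⟨
      countAt p C + sum {k} (λ _ → countBelow (p ∷ʳ r) C) ≡⟨ cong (countAt p C +_) (sum-cong-≗ {k} λ j → equal-sizes B p j r) ⟨
      countAt p C + sum (λ j → countBelow (p ∷ʳ j) C)     ≡⟨ weightBelow-children one p C ⟨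
      countBelow p C                                     ≡⟨ count≡ ⟩
      k * K                                              ∎
      where open ≡-Reasoning
    split : ∀ r → countAt p C ≡ 0 × countBelow (p ∷ʳ r) C ≡ K
    split r = remainder-zero (countAt p C) _ K at-p<k (total r)

  stable-lands : ∀ {C : Config k N} → Balanced C → Stable C → ∀ i m (p u : Vertex k) → C i ≡ p ++ u → length u ≡ m →
                 countBelow p C ≡ k ^ m → Lands m u (rankBelow i p C)
  stable-lands {C} B stable i zero p [] Ci≡p _ count≡1 =
    n<1⇒n≡0 (≤-trans (rankBelow<countBelow C i p ([] , sym Ci≡p)) (≤-reflexive count≡1))
  stable-lands {C} B stable i (suc m) p (r ∷ u) Ci≡p length≡ count≡ = y , (lower , upper , y<) , IH
    where
    X : Fin k → ℕ
    X j = rankBelow i (p ∷ʳ j) C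
    y = X r
    i-below-r : (p ∷ʳ r) ≼ C i
    i-below-r = u , trans (∷ʳ-++ p r u) (sym Ci≡p)
    split = stable-split B stable p (k ^ m) count≡
    rank-sum : rankBelow i p C ≡ sum X
    rank-sum = trans (weightBelow-children (smaller i) p C) (cong (_+ sum X) (n≤0⇒n≡0 (begin
      rankAt i p C  ≤⟨ sum-mono-≤ (λ x → *-monoˡ-≤ (𝟙 (C x ≟ᵥ p)) (smaller≤1 i x)) ⟩
      countAt p C   ≡⟨ proj₁ split ⟩
      0             ∎)))
      where open ≤-Reasoning
    bounds = rank-sum-bounds X r (k ^ m) (λ a b → rank-antitone B p i a b) (λ a → rank-strict B p i r a i-below-r)
               (λ a → ≤-trans (sum-mono-≤ λ x → *-monoˡ-≤ (𝟙 ((p ∷ʳ a) ≼? C x)) (smaller≤1 i x)) (≤-reflexive (proj₂ split a)))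
    lower : y * suc (toℕ r) + toℕ r ≤ rankBelow i p C
    lower = ≤-trans (proj₁ bounds) (≤-reflexive (sym rank-sum))
    upper : rankBelow i p C + y * toℕ r ≤ y * k + k ^ m * toℕ r
    upper = ≤-trans (≤-reflexive (cong (_+ y * toℕ r) rank-sum)) (proj₂ bounds)
    y< : y < k ^ m
    y< = ≤-trans (rankBelow<countBelow C i (p ∷ʳ r) i-below-r) (≤-reflexive (proj₂ split r))
    IH = stable-lands B stable i m (p ∷ʳ r) u (trans Ci≡p (sym (∷ʳ-++ p r u))) (suc-injective length≡) (proj₂ split r)

  landed⇒lands : ∀ n {C : Config k N} → N ≡ k ^ n → Star Step initial C → Stable C → ∀ i (u : Vertex k) →
                 length u ≡ n → C i ≡ u → Lands n u (toℕ i)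
  landed⇒lands n {C} N≡ steps stable i u length≡ Ci≡u =
    subst (Lands n u) rank≡ (stable-lands (balanced-reachable steps) stable i n [] u Ci≡u length≡ (trans count≡ N≡))
    where
    count≡ : countBelow [] C ≡ N
    count≡ = trans (sum-const N 1) (*-identityʳ N)
    rank≡ : rankBelow i [] C ≡ toℕ i
    rank≡ = trans (sum-cong-≗ {N} λ x → *-identityʳ (smaller i x)) (count-< (toℕ i) (<⇒≤ (toℕ<n i)))

-- Every admissible rank is realised by a firing strategy

crossing : ∀ (h : ℕ → ℕ) {q} n → h 0 ≤ q → q < h n → ∃ λ θ → θ < n × h θ ≤ q × q < h (suc θ)
crossing h zero h0≤q q<h0 = ⊥-elim (<⇒≱ q<h0 h0≤q)
crossing h {q} (suc n) h0≤q q<h with q <? h n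
... | yes q<hn = let θ , θ<n , rest = crossing h n h0≤q q<hn in θ , m≤n⇒m≤1+n θ<n , rest
... | no q≮hn = n , ≤-refl , ≮⇒≥ q≮hn , q<h

module _ {k N : ℕ} where

  countBefore : ℕ → Vertex k → Config k N → ℕ
  countBefore θ a C = sum (λ y → 𝟙 (toℕ y <? θ) * 𝟙 (C y ≟ᵥ a))

  countBefore-suc : ∀ (C : Config k N) a x → countBefore (suc (toℕ x)) a C ≡ rankAt x a C + 𝟙 (C x ≟ᵥ a)
  countBefore-suc C a x = begin
    countBefore (suc (toℕ x)) a C
      ≡⟨ sum-cong-≗ {N} (λ y → trans (cong (_* 𝟙 (C y ≟ᵥ a)) (𝟙-<-suc y)) (*-distribʳ-+ (𝟙 (C y ≟ᵥ a)) (smaller x y) (𝟙 (y Fin.≟ x)))) ⟩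
    sum (λ y → smaller x y * 𝟙 (C y ≟ᵥ a) + 𝟙 (y Fin.≟ x) * 𝟙 (C y ≟ᵥ a))
      ≡⟨ ∑-distrib-+ (λ y → smaller x y * 𝟙 (C y ≟ᵥ a)) _ ⟩
    rankAt x a C + sum (λ y → 𝟙 (y Fin.≟ x) * 𝟙 (C y ≟ᵥ a))
      ≡⟨ cong (rankAt x a C +_) (trans (sum-cong-≗ {N} λ y → *-comm (𝟙 (y Fin.≟ x)) _)
                                        (sum-𝟙-unique (Fin._≟ x) (λ y → 𝟙 (C y ≟ᵥ a)) x refl (λ _ → id))) ⟩
    rankAt x a C + 𝟙 (C x ≟ᵥ a) ∎
    where
    open ≡-Reasoning
    𝟙-<-suc : ∀ y → 𝟙 (toℕ y <? suc (toℕ x)) ≡ smaller x y + 𝟙 (y Fin.≟ x)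
    𝟙-<-suc y with toℕ y <? suc (toℕ x) | toℕ y <? toℕ x | y Fin.≟ x
    ... | _ | yes y<x | yes refl = ⊥-elim (<-irrefl refl y<x)
    ... | yes _ | yes _ | no _ = refl
    ... | yes _ | no _ | yes _ = refl
    ... | yes y<1+x | no y≮x | no y≢x = ⊥-elim ([ y≮x , y≢x ∘ toℕ-injective ]′ (m<1+n⇒m<n∨m≡n y<1+x))
    ... | no y≮1+x | yes y<x | _ = ⊥-elim (y≮1+x (m≤n⇒m≤1+n y<x))
    ... | no y≮1+x | no _ | yes refl = ⊥-elim (y≮1+x ≤-refl)
    ... | no _ | no _ | no _ = refl

  chip-of-rank : ∀ (C : Config k N) a q → q < countAt a C → ∃ λ x → C x ≡ a × rankAt x a C ≡ q
  chip-of-rank C a q q<count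
    with crossing (λ θ → countBefore θ a C) {q} N (≤-trans (≤-reflexive before-0) z≤n) (≤-trans q<count (≤-reflexive count≡))
    where
    before-0 : countBefore 0 a C ≡ 0
    before-0 = sum-zero λ y → cong (_* 𝟙 (C y ≟ᵥ a)) (𝟙-no (λ ()) (toℕ y <? 0))
    count≡ : countAt a C ≡ countBefore N a C
    count≡ = sum-cong-≗ {N} λ y → cong (_* 𝟙 (C y ≟ᵥ a)) (sym (𝟙-yes (toℕ<n y) (toℕ y <? N)))
  ... | θ , θ<N , before≤q , q<after = x , Cx≡a , rank≡q
    where
    x = fromℕ< θ<N
    after≡ : countBefore (suc θ) a C ≡ countBefore θ a C + 𝟙 (C x ≟ᵥ a)
    after≡ = subst (λ z → countBefore (suc z) a C ≡ countBefore z a C + 𝟙 (C x ≟ᵥ a)) (toℕ-fromℕ< θ<N) (countBefore-suc C a x)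
    Cx≡a : C x ≡ a
    Cx≡a with C x ≟ᵥ a | after≡
    ... | yes eq | _ = eq
    ... | no _ | after≡′ = ⊥-elim (<⇒≱ q<after (≤-trans (≤-reflexive (trans after≡′ (+-identityʳ _))) before≤q))
    rank≡q : rankAt x a C ≡ q
    rank≡q = trans (cong (λ z → countBefore z a C) (toℕ-fromℕ< θ<N)) (≤-antisym before≤q (≤-pred (begin
      suc q                             ≤⟨ q<after ⟩
      countBefore (suc θ) a C           ≡⟨ after≡ ⟩
      countBefore θ a C + 𝟙 (C x ≟ᵥ a)  ≡⟨ cong (countBefore θ a C +_) (𝟙-yes Cx≡a (C x ≟ᵥ a)) ⟩
      countBefore θ a C + 1             ≡⟨ +-comm _ 1 ⟩
      suc (countBefore θ a C)           ∎)))
      where open ≤-Reasoning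

  rankAt-< : ∀ (C : Config k N) a {x x′} → C x ≡ a → toℕ x < toℕ x′ → rankAt x a C < rankAt x′ a C
  rankAt-< C a {x} {x′} Cx≡a x<x′ =
    weighted-rank< (λ y → 𝟙 (C y ≟ᵥ a)) (𝟙-yes Cx≡a (C x ≟ᵥ a)) (smaller-mono (<⇒≤ x<x′))
      (subst₂ _<_ (sym (smaller-irrefl x)) (sym (𝟙-yes x<x′ (toℕ x <? toℕ x′))) ≤-refl)

  rankAt<countAt : ∀ (C : Config k N) a {x} → C x ≡ a → rankAt x a C < countAt a C
  rankAt<countAt C a {x} Cx≡a =
    weighted-rank< (λ y → 𝟙 (C y ≟ᵥ a)) (𝟙-yes Cx≡a (C x ≟ᵥ a)) (smaller≤1 x) (≤-reflexive (cong suc (smaller-irrefl x)))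

  rankAt-mono : ∀ (C : Config k N) a {x x′} → toℕ x ≤ toℕ x′ → rankAt x a C ≤ rankAt x′ a C
  rankAt-mono C a x≤x′ = sum-mono-≤ λ y → *-monoˡ-≤ (𝟙 (C y ≟ᵥ a)) (smaller-mono x≤x′ y)

  rankAt-cancel-< : ∀ (C : Config k N) a {x x′} → rankAt x a C < rankAt x′ a C → toℕ x < toℕ x′
  rankAt-cancel-< C a {x} {x′} rank< with toℕ x <? toℕ x′
  ... | yes x<x′ = x<x′
  ... | no x≮x′ = ⊥-elim (<⇒≱ rank< (rankAt-mono C a (≮⇒≥ x≮x′)))

  rankAt-injective : ∀ (C : Config k N) a {x x′} → C x ≡ a → C x′ ≡ a → rankAt x a C ≡ rankAt x′ a C → x ≡ x′
  rankAt-injective C a {x} {x′} Cx≡a Cx′≡a rank≡ with Finₚ.<-cmp x x′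
  ... | tri< x<x′ _ _ = ⊥-elim (<-irrefl rank≡ (rankAt-< C a Cx≡a x<x′))
  ... | tri≈ _ x≡x′ _ = x≡x′
  ... | tri> _ _ x′<x = ⊥-elim (<-irrefl (sym rank≡) (rankAt-< C a Cx′≡a x′<x))

  module FireRanks (C : Config k N) (a : Vertex k) (φ : Fin k → ℕ)
                   (φ-increasing : ∀ q q′ → toℕ q < toℕ q′ → φ q < φ q′) (φ<count : ∀ q → φ q < countAt a C) where

    chip : Fin k → Fin N
    chip q = proj₁ (chip-of-rank C a (φ q) (φ<count q))

    chip-at : ∀ q → C (chip q) ≡ a
    chip-at q = proj₁ (proj₂ (chip-of-rank C a (φ q) (φ<count q)))

    chip-rank : ∀ q → rankAt (chip q) a C ≡ φ q
    chip-rank q = proj₂ (proj₂ (chip-of-rank C a (φ q) (φ<count q)))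

    chip-increasing : StrictlyIncreasing chip
    chip-increasing q q′ q<q′ = rankAt-cancel-< C a (subst₂ _<_ (sym (chip-rank q)) (sym (chip-rank q′)) (φ-increasing q q′ q<q′))

    open Firing C a chip (increasing⇒injective chip-increasing) chip-at public

    step : Step C C′
    step = fire a chip chip-increasing chip-at

    fired-or-unfired : ∀ x → (∃ λ q → chip q ≡ x) ⊎ C′ x ≡ C x
    fired-or-unfired x with any? (λ q → x Fin.≟ chip q)
    ... | yes (q , refl) = inj₁ (q , refl)
    ... | no ∄q = inj₂ (unfired x λ q eq → ∄q (q , sym eq))

    elsewhere-unfired : ∀ x → C x ≢ a → C′ x ≡ C x
    elsewhere-unfired x Cx≢a = unfired x λ q eq → Cx≢a (subst (λ z → C z ≡ a) eq (chip-at q))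

    child-unfired : ∀ x s → C x ≡ a ∷ʳ s → C′ x ≡ a ∷ʳ s
    child-unfired x s Cx≡as = trans (elsewhere-unfired x (child≢parent a s ∘ trans (sym Cx≡as))) Cx≡as

    countAt-fired : countAt a C′ + k ≡ countAt a C
    countAt-fired = trans (cong (countAt a C′ +_) (sym (trans (sum-const k 1) (*-identityʳ k)))) (weightAt-fired one)

  module RootPhase (B : Config k N) (p : Vertex k) (i : Fin N) (r₀ : Fin k) (M y₀ : ℕ) where

    record Spreading (C : Config k N) (M′ ρ y′ : ℕ) : Set where
      field
        others-fixed   : ∀ x → B x ≢ p → C x ≡ B x
        near-root      : ∀ x → B x ≡ p → C x ≡ p ⊎ ∃ λ s → C x ≡ p ∷ʳ s
        count-root     : countAt p C ≡ M′ * k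
        i-at-root      : C i ≡ p
        i-rank         : rankAt i p C ≡ ρ
        count-children : ∀ s → countAt (p ∷ʳ s) C + M′ ≡ M
        i-child-rank   : rankAt i (p ∷ʳ r₀) C + y′ ≡ y₀
        descends       : Descends k M′ ρ (toℕ r₀) y′

    record Spread (C : Config k N) : Set where
      field
        others-fixed   : ∀ x → B x ≢ p → C x ≡ B x
        at-children    : ∀ x → B x ≡ p → ∃ λ s → C x ≡ p ∷ʳ s
        count-children : ∀ s → countAt (p ∷ʳ s) C ≡ M
        i-at-child     : C i ≡ p ∷ʳ r₀
        i-child-rank   : rankAt i (p ∷ʳ r₀) C ≡ y₀

    still-fixed : ∀ {C C′ : Config k N} → (∀ x → C x ≢ p → C′ x ≡ C x) → (∀ x → B x ≢ p → C x ≡ B x) →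
                  ∀ x → B x ≢ p → C′ x ≡ B x
    still-fixed unmoved fixed x Bx≢p = trans (unmoved x (Bx≢p ∘ trans (sym (fixed x Bx≢p)))) (fixed x Bx≢p)

    spread-last : ∀ C ρ y′ → Spreading C 1 ρ y′ → ∃ λ C′ → Star Step C C′ × Spread C′
    spread-last C ρ (suc y′) S with Spreading.descends S
    ... | _ , _ , s≤s ()
    spread-last C ρ zero S = C′ , step ◅ ε , record
      { others-fixed = still-fixed elsewhere-unfired others-fixed
      ; at-children = at-children
      ; count-children = λ s → trans (weightAt-child one s) (count-children s)
      ; i-at-child = trans (cong C′ (sym chip-r₀)) (fired r₀)
      ; i-child-rank = trans (weightAt-child (smaller i) r₀)
                             (trans (cong (rankAt i (p ∷ʳ r₀) C +_) (trans (cong (λ c → smaller i c) chip-r₀) (smaller-irrefl i)))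
                                    i-child-rank) }
      where
      open Spreading S
      count≡k : countAt p C ≡ k
      count≡k = trans count-root (+-identityʳ k)
      open FireRanks C p toℕ (λ _ _ → id) (λ q → ≤-trans (toℕ<n q) (≤-reflexive (sym count≡k)))
      ρ≡r₀ : ρ ≡ toℕ r₀
      ρ≡r₀ = ≤-antisym (≤-trans (m≤m+n ρ 0) (≤-trans (proj₁ (proj₂ descends)) (≤-reflexive (+-identityʳ _)))) (proj₁ descends)
      chip-r₀ : chip r₀ ≡ i
      chip-r₀ = rankAt-injective C p (chip-at r₀) i-at-root (trans (chip-rank r₀) (sym (trans i-rank ρ≡r₀)))
      at-children : ∀ x → B x ≡ p → ∃ λ s → C′ x ≡ p ∷ʳ s
      at-children x Bx≡p with near-root x Bx≡p
      ... | inj₂ (s , Cx≡ps) = s , child-unfired x s Cx≡ps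
      ... | inj₁ Cx≡p = q , trans (cong C′ (sym chip-q)) (fired q)
        where
        rank<k : rankAt x p C < k
        rank<k = ≤-trans (rankAt<countAt C p Cx≡p) (≤-reflexive count≡k)
        q = fromℕ< rank<k
        chip-q : chip q ≡ x
        chip-q = rankAt-injective C p (chip-at q) Cx≡p (trans (chip-rank q) (toℕ-fromℕ< rank<k))

    -- A firing at the root that leaves the chip i of rank ρ = j + ρ′ there: it fires the j smallest
    -- chips and the k - j largest ones.
    module Peel {M′ C ρ y′} (S : Spreading C (suc (suc M′)) ρ y′) {j ρ′} (j≤k : j ≤ k) (ρ≡ : ρ ≡ j + ρ′)
                (ρ′< : ρ′ < suc M′ * k) where
      open Spreading S

      K = suc M′ * k

      φ : Fin k → ℕ
      φ q = toℕ q + K * 𝟙 (j ≤? toℕ q)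

      φ-increasing : ∀ q q′ → toℕ q < toℕ q′ → φ q < φ q′
      φ-increasing q q′ q<q′ = +-mono-<-≤ q<q′ (*-monoʳ-≤ K (𝟙-mono (λ j≤q → ≤-trans j≤q (<⇒≤ q<q′)) _ _))

      φ<count : ∀ q → φ q < countAt p C
      φ<count q = <-≤-trans (+-mono-<-≤ (toℕ<n q) (≤-trans (*-monoʳ-≤ K (𝟙≤1 (j ≤? toℕ q))) (≤-reflexive (*-identityʳ K))))
                            (≤-reflexive (sym count-root))

      open FireRanks C p φ φ-increasing φ<count public

      below-or-above : ∀ q → toℕ q < j × φ q < ρ ⊎ j ≤ toℕ q × ρ < φ q
      below-or-above q with j ≤? toℕ q
      ... | no j≰q = inj₁ (≰⇒> j≰q , (begin-strict
        toℕ q + K * 0 ≡⟨ trans (cong (toℕ q +_) (*-zeroʳ K)) (+-identityʳ (toℕ q)) ⟩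
        toℕ q         <⟨ ≰⇒> j≰q ⟩
        j             ≤⟨ m≤m+n j ρ′ ⟩
        j + ρ′        ≡⟨ ρ≡ ⟨
        ρ             ∎))
        where open ≤-Reasoning
      ... | yes j≤q = inj₂ (j≤q , (begin-strict
        ρ             ≡⟨ ρ≡ ⟩
        j + ρ′        <⟨ +-mono-≤-< j≤q ρ′< ⟩
        toℕ q + K     ≡⟨ cong (toℕ q +_) (*-identityʳ K) ⟨
        toℕ q + K * 1 ∎))
        where open ≤-Reasoning

      smaller-chip : ∀ q → smaller i (chip q) ≡ 𝟙 (toℕ q <? j)
      smaller-chip q = 𝟙-cong to from (toℕ (chip q) <? toℕ i) (toℕ q <? j)
        where
        to : toℕ (chip q) < toℕ i → toℕ q < j
        to chip<i with below-or-above q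
        ... | inj₁ (q<j , _) = q<j
        ... | inj₂ (_ , ρ<φ) = ⊥-elim (<-asym chip<i (rankAt-cancel-< C p (subst₂ _<_ (sym i-rank) (sym (chip-rank q)) ρ<φ)))
        from : toℕ q < j → toℕ (chip q) < toℕ i
        from q<j with below-or-above q
        ... | inj₁ (_ , φ<ρ) = rankAt-cancel-< C p (subst₂ _<_ (sym (chip-rank q)) (sym i-rank) φ<ρ)
        ... | inj₂ (j≤q , _) = ⊥-elim (<⇒≱ q<j j≤q)

      chip≢i : ∀ q → chip q ≢ i
      chip≢i q chip≡i with below-or-above q | trans (sym (chip-rank q)) (trans (cong (λ c → rankAt c p C) chip≡i) i-rank)
      ... | inj₁ (_ , φ<ρ) | φ≡ρ = <-irrefl φ≡ρ φ<ρ
      ... | inj₂ (_ , ρ<φ) | φ≡ρ = <-irrefl (sym φ≡ρ) ρ<φ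

      fired-smaller : sum (λ q → smaller i (chip q)) ≡ j
      fired-smaller = trans (sum-cong-≗ {k} smaller-chip) (count-< j j≤k)

      near-root′ : ∀ x → B x ≡ p → C′ x ≡ p ⊎ ∃ λ s → C′ x ≡ p ∷ʳ s
      near-root′ x Bx≡p with near-root x Bx≡p
      ... | inj₂ (s , Cx≡ps) = inj₂ (s , child-unfired x s Cx≡ps)
      ... | inj₁ Cx≡p with fired-or-unfired x
      ...   | inj₁ (q , refl) = inj₂ (q , fired q)
      ...   | inj₂ C′x≡Cx = inj₁ (trans C′x≡Cx Cx≡p)

    spread-step : ∀ M′ C ρ y′ → Spreading C (suc (suc M′)) ρ y′ →
                  ∃ λ ρ′ → ∃ λ y″ → ∃ λ C′ → Step C C′ × Spreading C′ (suc M′) ρ′ y″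
    spread-step M′ C ρ y′ S with descends-peel (Spreading.descends S) (toℕ<n r₀)
    ... | j , ρ′ , y″ , j≤k , ρ≡ , descends′ , child-case = ρ′ , y″ , C′ , step , record
      { others-fixed = still-fixed elsewhere-unfired others-fixed
      ; near-root = near-root′
      ; count-root = +-cancelʳ-≡ k _ K (trans countAt-fired (trans count-root (+-comm k K)))
      ; i-at-root = trans (unfired i chip≢i) i-at-root
      ; i-rank = +-cancelˡ-≡ j _ ρ′ (trans (+-comm j _) (trans (cong (rankAt i p C′ +_) (sym fired-smaller))
                                                                 (trans (weightAt-fired (smaller i)) (trans i-rank ρ≡))))
      ; count-children = λ s → trans (cong (_+ suc M′) (weightAt-child one s)) (trans (+-assoc _ 1 (suc M′)) (count-children s))
      ; i-child-rank = begin
          rankAt i (p ∷ʳ r₀) C′ + y″                            ≡⟨ cong (_+ y″) (weightAt-child (smaller i) r₀) ⟩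
          rankAt i (p ∷ʳ r₀) C + smaller i (chip r₀) + y″        ≡⟨ +-assoc (rankAt i (p ∷ʳ r₀) C) (smaller i (chip r₀)) y″ ⟩
          rankAt i (p ∷ʳ r₀) C + (smaller i (chip r₀) + y″)      ≡⟨ cong (λ z → rankAt i (p ∷ʳ r₀) C + (z + y″)) (smaller-chip r₀) ⟩
          rankAt i (p ∷ʳ r₀) C + (𝟙 (toℕ r₀ <? j) + y″)          ≡⟨ cong (rankAt i (p ∷ʳ r₀) C +_) (y′≡ child-case) ⟩
          rankAt i (p ∷ʳ r₀) C + y′                             ≡⟨ i-child-rank ⟩
          y₀                                                    ∎
      ; descends = descends′ }
      where
      open Spreading S
      open Peel S j≤k ρ≡ (descends⇒< descends′ (toℕ<n r₀))
      open ≡-Reasoning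
      y′≡ : toℕ r₀ < j × y′ ≡ suc y″ ⊎ j ≤ toℕ r₀ × y′ ≡ y″ → 𝟙 (toℕ r₀ <? j) + y″ ≡ y′
      y′≡ (inj₁ (r₀<j , refl)) = cong (_+ y″) (𝟙-yes r₀<j (toℕ r₀ <? j))
      y′≡ (inj₂ (j≤r₀ , refl)) = cong (_+ y″) (𝟙-no (λ r₀<j → <⇒≱ r₀<j j≤r₀) (toℕ r₀ <? j))

    spread : ∀ M′ C ρ y′ → Spreading C M′ ρ y′ → ∃ λ C′ → Star Step C C′ × Spread C′
    spread zero C ρ y′ S with Spreading.descends S
    ... | _ , _ , ()
    spread (suc zero) = spread-last
    spread (suc (suc M′)) C ρ y′ S =
      let ρ′ , y″ , C₁ , step₁ , S₁ = spread-step M′ C ρ y′ S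
          C′ , steps , done = spread (suc M′) C₁ ρ′ y″ S₁
      in C′ , step₁ ◅ steps , done

  NothingBelow : Config k N → Vertex k → Set
  NothingBelow B p = ∀ x s w → B x ≢ p ++ (s ∷ w)

  record Settled (B : Config k N) (p : Vertex k) (i : Fin N) (u : Vertex k) (B′ : Config k N) : Set where
    field
      others-fixed : ∀ x → B x ≢ p → B′ x ≡ B x
      below        : ∀ x → B x ≡ p → ∃ λ w → B′ x ≡ p ++ w
      separated    : ∀ x x′ → B x ≡ p → B x′ ≡ p → B′ x ≡ B′ x′ → x ≡ x′
      i-lands      : B′ i ≡ p ++ u

  Settles : ℕ → Set
  Settles m = ∀ u y → Lands m u y → ∀ (B : Config k N) p i → countAt p B ≡ k ^ m → B i ≡ p → rankAt i p B ≡ y →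
              NothingBelow B p → ∃ λ B′ → Star Step B B′ × Settled B p i u B′

  weightAt-cong : ∀ {C C′ : Config k N} a → (∀ x → C x ≡ a → C′ x ≡ a) → (∀ x → C′ x ≡ a → C x ≡ a) →
                  ∀ g → weightAt g a C ≡ weightAt g a C′
  weightAt-cong {C} {C′} a to from g = sum-cong-≗ {N} λ x → cong (g x *_) (𝟙-cong (to x) (from x) (C x ≟ᵥ a) (C′ x ≟ᵥ a))

  module ChildrenPhase (m : ℕ) (settle-child : Settles m) (B : Config k N) (p : Vertex k) (i : Fin N) (r₀ : Fin k)
                       (u′ : Vertex k) (y₀ : ℕ) (u′-lands : Lands m u′ y₀) (nothing-below : NothingBelow B p)
                       (C₀ : Config k N) (spread : RootPhase.Spread B p i r₀ (k ^ m) y₀ C₀) where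
    module Sp = RootPhase.Spread spread

    record SettledUpTo (n : ℕ) (C : Config k N) : Set where
      field
        others-fixed : ∀ x → B x ≢ p → C x ≡ B x
        unsettled    : ∀ x s → C₀ x ≡ p ∷ʳ s → n ≤ toℕ s → C x ≡ p ∷ʳ s
        settled      : ∀ x s → C₀ x ≡ p ∷ʳ s → toℕ s < n → ∃ λ w → C x ≡ p ++ (s ∷ w)
        separated    : ∀ x x′ s s′ → C₀ x ≡ p ∷ʳ s → C₀ x′ ≡ p ∷ʳ s′ → toℕ s < n → toℕ s′ < n → C x ≡ C x′ → x ≡ x′
        i-lands      : toℕ r₀ < n → C i ≡ p ++ (r₀ ∷ u′)

    settled-none : SettledUpTo 0 C₀
    settled-none = record
      { others-fixed = Sp.others-fixed ; unsettled = λ _ _ C₀x≡ _ → C₀x≡ ; settled = λ _ _ _ ()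
      ; separated = λ _ _ _ _ _ _ () ; i-lands = λ () }

    k>0 : k > 0
    k>0 = ≤-<-trans z≤n (toℕ<n r₀)

    leftmost : Fin k
    leftmost = fromℕ< k>0

    smallest-lands-leftmost : ∀ m′ → Lands m′ (replicate m′ leftmost) 0
    smallest-lands-leftmost zero = refl
    smallest-lands-leftmost (suc m′) =
      0 , (≤-reflexive (toℕ-fromℕ< k>0) , z≤n , m^n>0 k {{>-nonZero k>0}} m′) , smallest-lands-leftmost m′

    module NextChild (n : ℕ) (n<k : n < k) (C : Config k N) (D : SettledUpTo n C) where
      open SettledUpTo D

      s* : Fin k
      s* = fromℕ< n<k

      p′ : Vertex k
      p′ = p ∷ʳ s*

      s≡s* : ∀ {s} → toℕ s ≡ n → s ≡ s*
      s≡s* s≡n = toℕ-injective (trans s≡n (sym (toℕ-fromℕ< n<k)))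

      data Position (x : Fin N) : Set where
        outside : B x ≢ p → C x ≡ B x → Position x
        waiting : ∀ s → C₀ x ≡ p ∷ʳ s → n ≤ toℕ s → C x ≡ p ∷ʳ s → Position x
        done    : ∀ s → C₀ x ≡ p ∷ʳ s → toℕ s < n → ∀ w → C x ≡ p ++ (s ∷ w) → Position x

      position : ∀ x → Position x
      position x with B x ≟ᵥ p
      ... | no Bx≢p = outside Bx≢p (others-fixed x Bx≢p)
      ... | yes Bx≡p with Sp.at-children x Bx≡p
      ...   | s , C₀x≡ with n ≤? toℕ s
      ...     | yes n≤s = waiting s C₀x≡ n≤s (unsettled x s C₀x≡ n≤s)
      ...     | no n≰s = done s C₀x≡ (≰⇒> n≰s) _ (proj₂ (settled x s C₀x≡ (≰⇒> n≰s)))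

      done-not-at-p′ : ∀ {x s w} → toℕ s < n → C x ≡ p ++ (s ∷ w) → C x ≢ p′
      done-not-at-p′ s<n Cx≡ Cx≡p′ =
        <-irrefl (trans (cong toℕ (proj₁ (++-cancelˡ-∷ p (trans (sym Cx≡) Cx≡p′)))) (toℕ-fromℕ< n<k)) s<n

      outside-not-at-p′ : ∀ x → B x ≢ p → C x ≢ p′
      outside-not-at-p′ x Bx≢p Cx≡p′ = nothing-below x s* [] (trans (sym (others-fixed x Bx≢p)) Cx≡p′)

      at-p′⇒initially : ∀ x → C x ≡ p′ → C₀ x ≡ p′
      at-p′⇒initially x Cx≡p′ with position x
      ... | outside Bx≢p _ = ⊥-elim (outside-not-at-p′ x Bx≢p Cx≡p′)
      ... | waiting s C₀x≡ _ Cx≡ = trans C₀x≡ (cong (p ∷ʳ_) (proj₂ (∷ʳ-injective p p (trans (sym Cx≡) Cx≡p′))))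
      ... | done s _ s<n w Cx≡ = ⊥-elim (done-not-at-p′ s<n Cx≡ Cx≡p′)

      initially⇒at-p′ : ∀ x → C₀ x ≡ p′ → C x ≡ p′
      initially⇒at-p′ x C₀x≡p′ = unsettled x s* C₀x≡p′ (≤-reflexive (sym (toℕ-fromℕ< n<k)))

      same-at-p′ : ∀ g → weightAt g p′ C ≡ weightAt g p′ C₀
      same-at-p′ = weightAt-cong p′ at-p′⇒initially initially⇒at-p′

      nothing-below-p′ : NothingBelow C p′
      nothing-below-p′ x s w Cx≡ with position x | trans Cx≡ (∷ʳ-++ p s* (s ∷ w))
      ... | outside Bx≢p Cx≡Bx | Cx≡′ = nothing-below x s* (s ∷ w) (trans (sym Cx≡Bx) Cx≡′)
      ... | waiting s′ _ _ Cx≡ps′ | Cx≡′ with proj₂ (++-cancelˡ-∷ p (trans (sym Cx≡ps′) Cx≡′))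
      ...   | ()
      nothing-below-p′ x s w Cx≡ | done s′ _ s′<n w′ Cx≡ps′ | Cx≡′ =
        <-irrefl (trans (cong toℕ (proj₁ (++-cancelˡ-∷ p (trans (sym Cx≡ps′) Cx≡′)))) (toℕ-fromℕ< n<k)) s′<n

      module Advance {c u* C′} (T : Settled C p′ c u* C′) where
        module T = Settled T

        data Settling (x : Fin N) (s : Fin k) : Set where
          earlier : C′ x ≡ C x → ∀ w → C x ≡ p ++ (s ∷ w) → toℕ s < n → Settling x s
          now     : C x ≡ p′ → s ≡ s* → Settling x s

        settling : ∀ x s → C₀ x ≡ p ∷ʳ s → toℕ s < suc n → Settling x s
        settling x s C₀x≡ s<1+n with m<1+n⇒m<n∨m≡n s<1+n
        ... | inj₁ s<n = let w , Cx≡ = settled x s C₀x≡ s<n in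
                         earlier (T.others-fixed x (done-not-at-p′ s<n Cx≡)) w Cx≡ s<n
        ... | inj₂ s≡n = now (trans (unsettled x s C₀x≡ (≤-reflexive (sym s≡n))) (cong (p ∷ʳ_) (s≡s* s≡n))) (s≡s* s≡n)

        now≢earlier : ∀ {x x′ s′ w′} → C x ≡ p′ → C′ x′ ≡ p ++ (s′ ∷ w′) → toℕ s′ < n → C′ x ≢ C′ x′
        now≢earlier {x} Cx≡p′ C′x′≡ s′<n C′x≡C′x′ =
          let w , C′x≡ = T.below x Cx≡p′ in
          <-irrefl (trans (cong toℕ (sym (proj₁ (++-cancelˡ-∷ p (trans (sym (∷ʳ-++ p s* w)) (trans (sym C′x≡) (trans C′x≡C′x′ C′x′≡)))))))
                          (toℕ-fromℕ< n<k)) s′<n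

        advanced : (toℕ r₀ ≡ n → C′ i ≡ p ++ (r₀ ∷ u′)) → SettledUpTo (suc n) C′
        advanced i-now = record
          { others-fixed = λ x Bx≢p → trans (T.others-fixed x (outside-not-at-p′ x Bx≢p)) (others-fixed x Bx≢p)
          ; unsettled = unsettled′
          ; settled = settled′
          ; separated = separated′
          ; i-lands = i-lands′ }
          where
          unsettled′ : ∀ x s → C₀ x ≡ p ∷ʳ s → suc n ≤ toℕ s → C′ x ≡ p ∷ʳ s
          unsettled′ x s C₀x≡ n<s = trans (T.others-fixed x Cx≢p′) Cx≡
            where
            Cx≡ = unsettled x s C₀x≡ (<⇒≤ n<s)
            Cx≢p′ : C x ≢ p′
            Cx≢p′ Cx≡p′ = <-irrefl (sym (trans (cong toℕ (proj₂ (∷ʳ-injective p p (trans (sym Cx≡) Cx≡p′)))) (toℕ-fromℕ< n<k))) n<s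
          settled′ : ∀ x s → C₀ x ≡ p ∷ʳ s → toℕ s < suc n → ∃ λ w → C′ x ≡ p ++ (s ∷ w)
          settled′ x s C₀x≡ s<1+n with settling x s C₀x≡ s<1+n
          ... | earlier C′x≡Cx w Cx≡ _ = w , trans C′x≡Cx Cx≡
          ... | now Cx≡p′ refl = let w , C′x≡ = T.below x Cx≡p′ in w , trans C′x≡ (∷ʳ-++ p s* w)
          separated′ : ∀ x x′ s s′ → C₀ x ≡ p ∷ʳ s → C₀ x′ ≡ p ∷ʳ s′ → toℕ s < suc n → toℕ s′ < suc n → C′ x ≡ C′ x′ → x ≡ x′
          separated′ x x′ s s′ C₀x≡ C₀x′≡ s<1+n s′<1+n C′x≡C′x′
            with settling x s C₀x≡ s<1+n | settling x′ s′ C₀x′≡ s′<1+n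
          ... | earlier C′x≡Cx _ _ s<n | earlier C′x′≡Cx′ _ _ s′<n =
            separated x x′ s s′ C₀x≡ C₀x′≡ s<n s′<n (trans (sym C′x≡Cx) (trans C′x≡C′x′ C′x′≡Cx′))
          ... | now Cx≡p′ _ | now Cx′≡p′ _ = T.separated x x′ Cx≡p′ Cx′≡p′ C′x≡C′x′
          ... | now Cx≡p′ _ | earlier C′x′≡Cx′ w′ Cx′≡ s′<n = ⊥-elim (now≢earlier Cx≡p′ (trans C′x′≡Cx′ Cx′≡) s′<n C′x≡C′x′)
          ... | earlier C′x≡Cx w Cx≡ s<n | now Cx′≡p′ _ = ⊥-elim (now≢earlier Cx′≡p′ (trans C′x≡Cx Cx≡) s<n (sym C′x≡C′x′))
          i-lands′ : toℕ r₀ < suc n → C′ i ≡ p ++ (r₀ ∷ u′)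
          i-lands′ r₀<1+n with m<1+n⇒m<n∨m≡n r₀<1+n
          ... | inj₁ r₀<n = trans (T.others-fixed i (done-not-at-p′ r₀<n (i-lands r₀<n))) (i-lands r₀<n)
          ... | inj₂ r₀≡n = i-now r₀≡n

      count-p′ : countAt p′ C ≡ k ^ m
      count-p′ = trans (same-at-p′ one) (Sp.count-children s*)

      settle-next : ∃ λ C′ → Star Step C C′ × SettledUpTo (suc n) C′
      settle-next with toℕ r₀ ≟ n
      ... | yes r₀≡n =
        let C′ , steps , T = settle-child u′ y₀ u′-lands C p′ i count-p′ Ci≡p′ rank≡ nothing-below-p′
        in C′ , steps , Advance.advanced T λ _ → trans (Settled.i-lands T) (p′++u′≡ r₀≡s*)
        where
        r₀≡s* : r₀ ≡ s*
        r₀≡s* = s≡s* r₀≡n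
        Ci≡p′ : C i ≡ p′
        Ci≡p′ = trans (unsettled i r₀ Sp.i-at-child (≤-reflexive (sym r₀≡n))) (cong (p ∷ʳ_) r₀≡s*)
        p′++u′≡ : ∀ {s} → s ≡ s* → p′ ++ u′ ≡ p ++ (s ∷ u′)
        p′++u′≡ refl = ∷ʳ-++ p s* u′
        rank≡ : rankAt i p′ C ≡ y₀
        rank≡ = trans (same-at-p′ (smaller i)) (subst (λ s → rankAt i (p ∷ʳ s) C₀ ≡ y₀) r₀≡s* Sp.i-child-rank)
      -- Settles needs some chip with an admissible target: the smallest one can go to the leftmost leaf.
      ... | no r₀≢n =
        let c , Cc≡p′ , rank≡0 = chip-of-rank C p′ 0 (≤-trans (m^n>0 k {{>-nonZero k>0}} m) (≤-reflexive (sym count-p′)))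
            C′ , steps , T = settle-child (replicate m leftmost) 0 (smallest-lands-leftmost m)
                                          C p′ c count-p′ Cc≡p′ rank≡0 nothing-below-p′
        in C′ , steps , Advance.advanced T (⊥-elim ∘ r₀≢n)

    settle-children : ∀ n → n ≤ k → ∃ λ C → Star Step C₀ C × SettledUpTo n C
    settle-children zero _ = C₀ , ε , settled-none
    settle-children (suc n) n<k =
      let C , steps , D = settle-children n (<⇒≤ n<k)
          C′ , steps′ , D′ = NextChild.settle-next n n<k C D
      in C′ , steps ◅◅ steps′ , D′

    settle-below : ∃ λ C → Star Step C₀ C × Settled B p i (r₀ ∷ u′) C
    settle-below =
      let C , steps , D = settle-children k ≤-refl
          module D = SettledUpTo D
      in C , steps , record
        { others-fixed = D.others-fixed
        ; below = λ x Bx≡p → let s , C₀x≡ = Sp.at-children x Bx≡p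
                                 w , Cx≡ = D.settled x s C₀x≡ (toℕ<n s)
                             in s ∷ w , Cx≡
        ; separated = λ x x′ Bx≡p Bx′≡p → D.separated x x′ _ _ (proj₂ (Sp.at-children x Bx≡p)) (proj₂ (Sp.at-children x′ Bx′≡p))
                                            (toℕ<n _) (toℕ<n _)
        ; i-lands = D.i-lands (toℕ<n r₀) }

  settle : ∀ m → Settles m
  settle zero [] _ refl B p i count≡1 Bi≡p _ _ = B , ε , record
    { others-fixed = λ _ _ → refl
    ; below = λ x Bx≡p → [] , trans Bx≡p (sym (++-identityʳ p))
    ; separated = alone
    ; i-lands = trans Bi≡p (sym (++-identityʳ p)) }
    where
    alone : ∀ x x′ → B x ≡ p → B x′ ≡ p → B x ≡ B x′ → x ≡ x′
    alone x x′ Bx≡p Bx′≡p _ with x Fin.≟ x′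
    ... | yes x≡x′ = x≡x′
    ... | no x≢x′ = ⊥-elim (<-irrefl refl (begin-strict
      1                                               <⟨ ≤-refl ⟩
      2                                               ≡⟨ cong₂ (λ a b → 1 * a + 1 * b) (𝟙-yes Bx≡p (B x ≟ᵥ p)) (𝟙-yes Bx′≡p (B x′ ≟ᵥ p)) ⟨
      1 * 𝟙 (B x ≟ᵥ p) + 1 * 𝟙 (B x′ ≟ᵥ p)             ≤⟨ two-terms≤sum (λ z → one z * 𝟙 (B z ≟ᵥ p)) x≢x′ ⟩
      countAt p B                                     ≡⟨ count≡1 ⟩
      1                                               ∎))
      where open ≤-Reasoning
  settle zero (_ ∷ _) _ ()
  settle (suc m) [] _ ()
  settle (suc m) (r₀ ∷ u′) y (y₀ , y↓y₀ , u′-lands) B p i count≡ Bi≡p rank≡ nothing-below =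
    let C₀ , steps₀ , spread = RootPhase.spread B p i r₀ (k ^ m) y₀ (k ^ m) B y y₀ spreading
        C , steps , T = ChildrenPhase.settle-below m (settle m) B p i r₀ u′ y₀ u′-lands nothing-below C₀ spread
    in C , steps₀ ◅◅ steps , T
    where
    empty-child : ∀ g s → weightAt g (p ∷ʳ s) B ≡ 0
    empty-child g s = sum-𝟙-none (λ x → B x ≟ᵥ (p ∷ʳ s)) g (λ x → nothing-below x s [])
    spreading : RootPhase.Spreading B p i r₀ (k ^ m) y₀ B (k ^ m) y y₀
    spreading = record
      { others-fixed = λ _ _ → refl
      ; near-root = λ _ Bx≡p → inj₁ Bx≡p
      ; count-root = trans count≡ (*-comm k (k ^ m))
      ; i-at-root = Bi≡p
      ; i-rank = rank≡
      ; count-children = λ s → cong (_+ k ^ m) (empty-child one s)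
      ; i-child-rank = cong (_+ y₀) (empty-child (smaller i) r₀)
      ; descends = y↓y₀ }

canLand⇒lands : ∀ {k} n (t : Vec (Fin k) n) c → CanLand k n t c → Lands n (toList t) (pred c)
canLand⇒lands n t c (C , steps , stable , i , label≡c , Ci≡t) =
  subst (Lands n (toList t)) (cong pred label≡c) (landed⇒lands n refl steps stable i (toList t) (length-toList t) Ci≡t)

injective⇒stable : ∀ {k N} → 2 ≤ k → (C : Config k N) → Injective _≡_ _≡_ C → Stable C
injective⇒stable {k} {N} 2≤k C C-inj v = ≤-trans (s≤s (begin
  chipsAt C v                        ≡⟨ chipsAt≡countAt C v ⟩
  sum (λ x → 1 * 𝟙 (C x ≟ᵥ v))        ≡⟨ sum-cong-≗ {N} (λ x → +-identityʳ _) ⟩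
  sum (λ x → 𝟙 (C x ≟ᵥ v))            ≤⟨ count-unique≤1 (λ x → C x ≟ᵥ v) (λ x x′ Cx≡v Cx′≡v → C-inj (trans Cx≡v (sym Cx′≡v))) ⟩
  1                                  ∎)) 2≤k
  where open ≤-Reasoning

lands⇒canLand : ∀ {k} n (t : Vec (Fin k) n) c → 2 ≤ k → 1 ≤ c → c ≤ k ^ n → Lands n (toList t) (pred c) → CanLand k n t c
lands⇒canLand n t zero _ () _ _
lands⇒canLand {k} n t (suc c′) 2≤k _ c≤kⁿ c-lands =
  let C , steps , settled = settle n (toList t) c′ c-lands (initial {k} {k ^ n}) [] i count≡ refl rank≡ (λ _ _ _ ())
      open Settled settled
  in C , steps , injective⇒stable 2≤k C (separated _ _ refl refl) , i , cong suc (toℕ-fromℕ< c≤kⁿ) , i-lands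
  where
  i : Fin (k ^ n)
  i = fromℕ< c≤kⁿ
  count≡ : countAt [] (initial {k} {k ^ n}) ≡ k ^ n
  count≡ = trans (sum-const (k ^ n) 1) (*-identityʳ (k ^ n))
  rank≡ : rankAt i [] (initial {k} {k ^ n}) ≡ c′
  rank≡ = trans (sum-cong-≗ {k ^ n} λ x → *-identityʳ (smaller i x)) (trans (count-< (toℕ i) (<⇒≤ (toℕ<n i))) (toℕ-fromℕ< c≤kⁿ))

corollary8p1 : (k n : ℕ) → 2 ≤ k → 1 ≤ n → (t : Vec (Fin k) n) →
    (a b : ℕ) → IsA k n t a → IsB k n t b →
    (c : ℕ) → 1 ≤ c → c ≤ k ^ n →
    (CanLand k n t c ⇔ (a ≤ c × c ≤ b))
corollary8p1 k n 2≤k _ t a b (a-lands , a-least) (b-lands , b-greatest) c 1≤c c≤kⁿ =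
  mk⇔ (λ c-lands → a-least c c-lands , b-greatest c c-lands)
      (λ (a≤c , c≤b) → lands⇒canLand n t c 2≤k 1≤c c≤kⁿ
        (lands-interval n (toList t) (canLand⇒lands n t a a-lands) (canLand⇒lands n t b b-lands) (pred-mono-≤ a≤c) (pred-mono-≤ c≤b)))
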